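{- For all positive integers $m \leq n$, \[ |\mathrm{rSYT}(m,n)| \leq \frac{1}{m!\,n!} \sum_{i=0}^{m+n} \binom{2\binom{m}{2}\binom{n}{2} + \binom{m}{2} + \binom{n}{2}}{i} .\] In particular, $|\mathrm{rSYT}(n,n)| \leq n^{4n+o(n)}$ as $n\to\infty$.
   Context: For positive integers $m,n$, an $m\times n$ (rectangular) standard Young tableau is a bijection $T:[m]\times[n]\to\{1,\dots,mn\}$ that is increasing along rows and columns: $T(i,j)<T(i,j+1)$ and $T(i,j)<T(i+1,j)$ whenever defined. A vector $x\in\mathbb{R}^k$ is increasing if $x_1<x_2<\dots<x_k$. For increasing $x\in\mathbb{R}^m$, $y\in\mathbb{R}^n$ such that the $mn$ numbers $x_i+y_j$, $(i,j)\in[m]\times[n]$, are pairwise distinct, let $\mathcal T(x\circ y)$ be the tableau whose $(i,j)$ entry is the rank of $x_i+y_j$ among these $mn$ numbers (rank $1$ = smallest). An $m\times n$ standard Young tableau is realizable if it equals $\mathcal T(x\circ y)$ for some such $x,y$. $\mathrm{rSYT}(m,n)$ denotes the set of realizable $m\times n$ standard Young tableaux.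
   Formalization: The increasing vectors x and y that realize a tableau in rSYT(m,n) have rational entries instead of real ones. -}

module Defs where

open import Data.Nat as ℕ using (ℕ; zero; suc; _*_; _≤_; _∸_)
open import Data.Nat.Combinatorics using (_C_)
open import Data.Nat.Base using (_!)
open import Data.Fin as Fin using (Fin; toℕ)
open import Data.Vec using (Vec; lookup)
open import Data.List using (List; map; allFin; length)
open import Data.Nat.ListAction using (sum)
open import Data.List.Relation.Unary.All using (All)
open import Data.List.Relation.Unary.Unique.Propositional using (Unique)
open import Data.Rational as ℚ using (ℚ)
open import Data.Rational.Properties using (_<?_)
open import Data.Product using (Σ; ∃; ∃-syntax; _×_; _,_)
open import Data.Bool using (if_then_else_)
open import Relation.Nullary using (¬_; does)
open import Relation.Binary.PropositionalEquality using (_≡_)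

Tableau : ℕ → ℕ → Set
Tableau m n = Vec (Vec ℕ n) m

entry : ∀ {m n} → Tableau m n → Fin m → Fin n → ℕ
entry T i j = lookup (lookup T i) j

IsBijectionOnto : ∀ {m n} → Tableau m n → Set
IsBijectionOnto {m} {n} T =
  (∀ i j → 1 ≤ entry T i j × entry T i j ≤ m * n)
  × (∀ i j k l → entry T i j ≡ entry T k l → i ≡ k × j ≡ l)
  × (∀ v → 1 ≤ v → v ≤ m * n → ∃[ i ] ∃[ j ] entry T i j ≡ v)

IsSYT : ∀ {m n} → Tableau m n → Set
IsSYT {m} {n} T =
  IsBijectionOnto T
  × (∀ (i : Fin m) (j j' : Fin n) → toℕ j' ≡ suc (toℕ j) → entry T i j ℕ.< entry T i j')
  × (∀ (i i' : Fin m) (j : Fin n) → toℕ i' ≡ suc (toℕ i) → entry T i j ℕ.< entry T i' j)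

Increasing : ∀ {k} → (Fin k → ℚ) → Set
Increasing {k} x = ∀ (i j : Fin k) → i Fin.< j → x i ℚ.< x j

DistinctSums : ∀ {m n} → (Fin m → ℚ) → (Fin n → ℚ) → Set
DistinctSums {m} {n} x y =
  ∀ (i k : Fin m) (j l : Fin n) → x i ℚ.+ y j ≡ x k ℚ.+ y l → i ≡ k × j ≡ l

rank : ∀ {m n} → (Fin m → ℚ) → (Fin n → ℚ) → Fin m → Fin n → ℕ
rank {m} {n} x y i j =
  suc (sum (map (λ k → sum (map (λ l →
        if does (x k ℚ.+ y l <? x i ℚ.+ y j) then 1 else 0) (allFin n))) (allFin m)))

Realizable : ∀ {m n} → Tableau m n → Set
Realizable {m} {n} T =
  ∃[ x ] ∃[ y ] (Increasing {m} x × Increasing {n} y × DistinctSums x y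
                 × (∀ i j → entry T i j ≡ rank x y i j))

IsRSYT : ∀ m n → Tableau m n → Set
IsRSYT m n T = IsSYT T × Realizable T

-- |rSYT(m,n)| ≤ K  : every duplicate-free list of elements of rSYT(m,n) has length ≤ K
-- (stated multiplied through by c, i.e. c·|rSYT(m,n)| ≤ K)
CardTimesLe : ∀ m n → ℕ → ℕ → Set
CardTimesLe m n c K =
  ∀ (L : List (Tableau m n)) → Unique L → All (IsRSYT m n) L → length L * c ≤ K

sumChoose : ℕ → ℕ → ℕ
sumChoose N zero = N C 0
sumChoose N (suc k) = sumChoose N k ℕ.+ N C suc k

boundN : ℕ → ℕ → ℕ
boundN m n = 2 * (m C 2) * (n C 2) ℕ.+ m C 2 ℕ.+ n C 2

{-# OPTIONS --safe #-}
module Submission where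

-- Let x ∈ ℚᵐ, y ∈ ℚⁿ realize T, and let σ, τ be permutations. The point (x ∘ σ, y ∘ τ) of ℚ^(m+n) lies
-- on none of the boundN m n hyperplanes x_a = x_b (a < b), y_j = y_l (j < l) and x_a + y_j = x_b + y_l
-- (a < b, j ≠ l), and the side of each hyperplane it lies on determines (T, σ, τ): the hyperplanes
-- x_a = x_b give the relative order of x ∘ σ, hence σ since x is increasing; likewise τ; and then every
-- comparison between two sums x_i + y_j, hence every rank, hence T. So the |rSYT(m,n)|·m!·n! points have
-- pairwise distinct sign vectors with respect to N = boundN m n linear forms on ℚᴰ, D = m + n. Such a
-- family of sign vectors shatters no D + 1 forms: these are linearly dependent, and no point can give
-- every term of the dependency the sign of its coefficient. Sauer–Shelah then bounds the number of
-- points by ∑_{i ≤ D} C(N, i). For m = n and M = boundN n n this sum is at most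
-- C(M + 2n, 2n) ≤ (M + 2n)^(2n) / (2n)! with M + 2n ≤ 4n⁴, and n^n ≤ 4ⁿ n! turns the bound into
-- |rSYT(n,n)| ≤ (1024 n⁴)ⁿ.

open import Data.Nat using (ℕ)

module ListProperties where

  open import Data.Nat using (_+_; _*_; suc)
  open import Data.Nat.Properties using (+-suc)
  open import Data.List using ([]; _∷_; length; map; filter; cartesianProductWith)
  open import Data.List.Properties using (length-++; length-map)
  open import Data.List.Relation.Unary.All using (All; []; _∷_)
  import Data.List.Relation.Unary.All as All
  open import Data.Product using (proj₁)
  open import Function using (_∘_)
  open import Relation.Nullary using (yes; no)
  open import Relation.Nullary.Decidable using (¬?)
  open import Relation.Unary using (Decidable)
  open import Relation.Binary.PropositionalEquality using (_≡_; refl; trans; cong; cong₂)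

  length-filter+filter-∁ : ∀ {A : Set} {P : A → Set} (P? : Decidable P) xs →
    length (filter P? xs) + length (filter (¬? ∘ P?) xs) ≡ length xs
  length-filter+filter-∁ P? [] = refl
  length-filter+filter-∁ P? (x ∷ xs) with P? x
  ... | yes _ = cong suc (length-filter+filter-∁ P? xs)
  ... | no  _ = trans (+-suc _ _) (cong suc (length-filter+filter-∁ P? xs))

  length-cartesianProductWith : ∀ {A B C : Set} (f : A → B → C) xs ys →
    length (cartesianProductWith f xs ys) ≡ length xs * length ys
  length-cartesianProductWith f []       ys = refl
  length-cartesianProductWith f (x ∷ xs) ys = trans (length-++ (map (f x) ys))
    (cong₂ _+_ (length-map (f x) ys) (length-cartesianProductWith f xs ys))

  map-proj₁-toList : ∀ {A : Set} {P : A → Set} {xs} (pxs : All P xs) → map proj₁ (All.toList pxs) ≡ xs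
  map-proj₁-toList []         = refl
  map-proj₁-toList (px ∷ pxs) = cong (_ ∷_) (map-proj₁-toList pxs)

module SauerShelah where

  open import Defs using (sumChoose)
  open import Data.Nat using (ℕ; zero; suc; _+_; _≤_; z≤n; s≤s)
  open import Data.Nat.Properties using (+-mono-≤; +-suc; +-identityʳ; +-comm)
  open import Data.Nat.Tactic.RingSolver using (solve-∀)
  open import Data.Nat.Combinatorics using (_C_; nCk+nC[k+1]≡[n+1]C[k+1])
  open import Data.Bool using (Bool; true; false)
  import Data.Bool.Properties as Bool
  open import Data.Fin using (Fin; zero; suc)
  open import Data.Vec using (Vec; []; _∷_; lookup; map)
  open import Data.Vec.Properties using (lookup-map; ≡-dec)
  open import Data.List using (List; []; _∷_; length; _++_; filter)
  open import Data.List.Properties using (length-++)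
  import Data.List.Relation.Unary.All as All
  open All using (_∷_)
  open import Data.List.Relation.Unary.Any using (here; there)
  open import Data.List.Membership.Propositional using (_∈_)
  import Data.List.Membership.DecPropositional as DecMembership
  open import Data.List.Membership.Propositional.Properties using (∈-++⁻; ∈-filter⁻)
  open import Data.List.Relation.Unary.Unique.Propositional using (Unique; []; _∷_)
  open import Data.List.Relation.Unary.Unique.Propositional.Properties using (filter⁺; ++⁺)
  open import Data.Product using (∃-syntax; _×_; _,_; proj₁; proj₂)
  open import Data.Sum using (inj₁; inj₂)
  open import Data.Empty using (⊥-elim)
  open import Function using (_∘_)
  open import Relation.Nullary using (¬_; yes; no)
  open import Relation.Binary.PropositionalEquality
    using (_≡_; refl; sym; trans; cong; cong₂; subst; module ≡-Reasoning)
  open ListProperties using (length-filter+filter-∁)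

  Shatters : ∀ {N k} → List (Vec Bool N) → Vec (Fin N) k → Set
  Shatters F S = ∀ bs → ∃[ v ] v ∈ F × ∀ i → lookup v (lookup S i) ≡ lookup bs i

  Φ : ℕ → ℕ → ℕ
  Φ N       zero    = 0
  Φ zero    (suc d) = 1
  Φ (suc N) (suc d) = Φ N (suc d) + Φ N d

  fibre : ∀ {N} → Bool → List (Vec Bool (suc N)) → List (Vec Bool N)
  fibre b [] = []
  fibre b ((c ∷ v) ∷ F) with c Bool.≟ b
  ... | yes _ = v ∷ fibre b F
  ... | no  _ = fibre b F

  ∈-fibre⁻ : ∀ {N b} (F : List (Vec Bool (suc N))) {v} → v ∈ fibre b F → (b ∷ v) ∈ F
  ∈-fibre⁻ {b = b} ((c ∷ w) ∷ F) v∈ with c Bool.≟ b | v∈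
  ... | yes refl | here refl = here refl
  ... | yes refl | there v∈′ = there (∈-fibre⁻ F v∈′)
  ... | no  _    | v∈′       = there (∈-fibre⁻ F v∈′)

  fibre⁺ : ∀ {N b} {F : List (Vec Bool (suc N))} → Unique F → Unique (fibre b F)
  fibre⁺ {F = []} [] = []
  fibre⁺ {b = b} {F = (c ∷ v) ∷ F} (v∉F ∷ F!) with c Bool.≟ b
  ... | yes refl = All.tabulate (λ w∈ v≡w → All.lookup v∉F (∈-fibre⁻ F w∈) (cong (c ∷_) v≡w)) ∷ fibre⁺ F!
  ... | no  _    = fibre⁺ F!

  length-fibres : ∀ {N} (F : List (Vec Bool (suc N))) →
    length (fibre false F) + length (fibre true F) ≡ length F
  length-fibres [] = refl
  length-fibres ((false ∷ v) ∷ F) = cong suc (length-fibres F)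
  length-fibres ((true  ∷ v) ∷ F) = trans (+-suc _ _) (cong suc (length-fibres F))

  module _ {N k : ℕ} {F : List (Vec Bool (suc N))} {G : List (Vec Bool N)} (S : Vec (Fin N) k) where

    lookup-∷-map-suc : ∀ (b : Bool) (v : Vec Bool N) i → lookup (b ∷ v) (lookup (map suc S) i) ≡ lookup v (lookup S i)
    lookup-∷-map-suc b v i = cong (lookup (b ∷ v)) (lookup-map i suc S)

    shatters-map-suc : (∀ {v} → v ∈ G → ∃[ b ] (b ∷ v) ∈ F) → Shatters G S → Shatters F (map suc S)
    shatters-map-suc lift G-sh bs =
      let v , v∈G , agree = G-sh bs ; b , bv∈F = lift v∈G
      in b ∷ v , bv∈F , λ i → trans (lookup-∷-map-suc b v i) (agree i)

    shatters-zero∷map-suc : (∀ {v} → v ∈ G → ∀ b → (b ∷ v) ∈ F) → Shatters G S → Shatters F (zero ∷ map suc S)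
    shatters-zero∷map-suc lift G-sh (b ∷ bs) =
      let v , v∈G , agree = G-sh bs
      in b ∷ v , lift v∈G b , λ { zero → refl ; (suc i) → trans (lookup-∷-map-suc b v i) (agree i) }

  sauer-shelah : ∀ N d (F : List (Vec Bool N)) → Unique F →
    (∀ (S : Vec (Fin N) d) → ¬ Shatters F S) → length F ≤ Φ N d
  sauer-shelah N zero [] _ _ = z≤n
  sauer-shelah N zero (v ∷ F) _ ¬sh = ⊥-elim (¬sh [] (λ _ → v , here refl , λ ()))
  sauer-shelah zero (suc d) [] _ _ = z≤n
  sauer-shelah zero (suc d) ([] ∷ []) _ _ = s≤s z≤n
  sauer-shelah zero (suc d) ([] ∷ [] ∷ _) ((≢[] ∷ _) ∷ _) _ = ⊥-elim (≢[] refl)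
  sauer-shelah (suc N) (suc d) F F! ¬sh = subst (_≤ Φ (suc N) (suc d)) length-F (+-mono-≤ U-bound I-bound)
    where
    open DecMembership (≡-dec {n = N} Bool._≟_) using (_∈?_; _∉?_)
    F₀ = fibre false F
    F₁ = fibre true F
    I = filter (_∈? F₁) F₀
    U = F₁ ++ filter (_∉? F₁) F₀

    length-F : length U + length I ≡ length F
    length-F = begin
      length U + length I                                ≡⟨ cong (_+ length I) (length-++ F₁) ⟩
      length F₁ + length (filter (_∉? F₁) F₀) + length I  ≡⟨ regroup (length F₁) _ (length I) ⟩
      length I + length (filter (_∉? F₁) F₀) + length F₁  ≡⟨ cong (_+ length F₁) (length-filter+filter-∁ (_∈? F₁) F₀) ⟩
      length F₀ + length F₁                               ≡⟨ length-fibres F ⟩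
      length F ∎
      where
      open ≡-Reasoning
      regroup : ∀ a b c → a + b + c ≡ c + b + a
      regroup = solve-∀

    U⇒F : ∀ {v} → v ∈ U → ∃[ b ] (b ∷ v) ∈ F
    U⇒F v∈U with ∈-++⁻ F₁ v∈U
    ... | inj₁ v∈F₁ = true , ∈-fibre⁻ F v∈F₁
    ... | inj₂ v∈F₀∖F₁ = false , ∈-fibre⁻ F (proj₁ (∈-filter⁻ (_∉? F₁) {xs = F₀} v∈F₀∖F₁))

    I⇒F : ∀ {v} → v ∈ I → ∀ b → (b ∷ v) ∈ F
    I⇒F v∈I false = ∈-fibre⁻ F (proj₁ (∈-filter⁻ (_∈? F₁) {xs = F₀} v∈I))
    I⇒F v∈I true  = ∈-fibre⁻ F (proj₂ (∈-filter⁻ (_∈? F₁) {xs = F₀} v∈I))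

    U! : Unique U
    U! = ++⁺ (fibre⁺ F!) (filter⁺ (_∉? F₁) {F₀} (fibre⁺ F!))
             (λ (v∈F₁ , v∈F₀∖F₁) → proj₂ (∈-filter⁻ (_∉? F₁) {xs = F₀} v∈F₀∖F₁) v∈F₁)

    U-bound : length U ≤ Φ N (suc d)
    U-bound = sauer-shelah N (suc d) U U! (λ S → ¬sh (map suc S) ∘ shatters-map-suc S U⇒F)

    I-bound : length I ≤ Φ N d
    I-bound = sauer-shelah N d I (filter⁺ (_∈? F₁) {F₀} (fibre⁺ F!))
                (λ S → ¬sh (zero ∷ map suc S) ∘ shatters-zero∷map-suc S I⇒F)

  sumChoose-suc : ∀ N k → sumChoose (suc N) (suc k) ≡ sumChoose N (suc k) + sumChoose N k
  sumChoose-suc N zero = begin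
    1 + suc N C 1          ≡⟨ cong (1 +_) (nCk+nC[k+1]≡[n+1]C[k+1] N 0) ⟨
    1 + (1 + N C 1)        ≡⟨ +-comm 1 _ ⟩
    (1 + N C 1) + 1        ∎
    where open ≡-Reasoning
  sumChoose-suc N (suc k) = begin
    sumChoose (suc N) (suc k) + suc N C suc (suc k)
      ≡⟨ cong₂ _+_ (sumChoose-suc N k) (sym (nCk+nC[k+1]≡[n+1]C[k+1] N (suc k))) ⟩
    (sumChoose N (suc k) + sumChoose N k) + (N C suc k + N C suc (suc k))
      ≡⟨ shuffle (sumChoose N (suc k)) (sumChoose N k) (N C suc k) (N C suc (suc k)) ⟩
    (sumChoose N (suc k) + N C suc (suc k)) + (sumChoose N k + N C suc k) ∎
    where
    open ≡-Reasoning
    shuffle : ∀ a b c d → (a + b) + (c + d) ≡ (a + d) + (b + c)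
    shuffle = solve-∀

  Φ-suc≡sumChoose : ∀ N d → Φ N (suc d) ≡ sumChoose N d
  Φ-suc≡sumChoose zero    d       = sym (sumChoose-0 d)
    where
    sumChoose-0 : ∀ d → sumChoose 0 d ≡ 1
    sumChoose-0 zero    = refl
    sumChoose-0 (suc d) = trans (+-identityʳ _) (sumChoose-0 d)
  Φ-suc≡sumChoose (suc N) zero    = trans (+-identityʳ _) (Φ-suc≡sumChoose N zero)
  Φ-suc≡sumChoose (suc N) (suc d) =
    trans (cong₂ _+_ (Φ-suc≡sumChoose N (suc d)) (Φ-suc≡sumChoose N d)) (sym (sumChoose-suc N d))

module ℚ-Lemmas where

  open import Data.Rational using (ℚ; 0ℚ; 1ℚ; _+_; _*_; -_; _-_; _<_; _≤_; 1/_; ≢-nonZero; positive; negative)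
  open import Data.Rational.Properties
  open import Data.Rational.Solver using (module +-*-Solver)
  open import Data.Empty using (⊥-elim)
  open import Relation.Nullary using (¬_; Dec; yes; no; does)
  open import Data.Bool using (Bool; true)
  open import Relation.Nullary.Decidable using (dec-true)
  open import Relation.Binary.Definitions using (tri<; tri≈; tri>)
  open import Relation.Binary.PropositionalEquality
    using (_≡_; _≢_; refl; sym; trans; cong; subst; subst₂; module ≡-Reasoning)
  open +-*-Solver

  isPositive : ℚ → Bool
  isPositive q = does (0ℚ <? q)

  *-≢0 : ∀ {a b} → a ≢ 0ℚ → b ≢ 0ℚ → a * b ≢ 0ℚ
  *-≢0 {a} {b} a≢0 b≢0 ab≡0 = b≢0 (begin
    b                ≡⟨ *-identityˡ b ⟨
    1ℚ * b           ≡⟨ cong (_* b) (*-inverseˡ a) ⟨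
    (1/ a * a) * b   ≡⟨ *-assoc (1/ a) a b ⟩
    1/ a * (a * b)   ≡⟨ cong (1/ a *_) ab≡0 ⟩
    1/ a * 0ℚ        ≡⟨ *-zeroʳ (1/ a) ⟩
    0ℚ               ∎)
    where
    open ≡-Reasoning
    instance _ = ≢-nonZero a≢0

  a<b⇒0<b-a : ∀ {a b} → a < b → 0ℚ < b - a
  a<b⇒0<b-a {a} {b} a<b = subst (_< b - a) (+-inverseʳ a) (+-monoˡ-< (- a) a<b)

  0<b-a⇒a<b : ∀ {a b} → 0ℚ < b - a → a < b
  0<b-a⇒a<b {a} {b} 0<b-a = subst₂ _<_ (+-identityˡ a) (solve 2 (λ a b → (b :- a) :+ a := b) refl a b) (+-monoˡ-< a 0<b-a)

  a-b≡0⇒a≡b : ∀ {a b} → a - b ≡ 0ℚ → a ≡ b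
  a-b≡0⇒a≡b {a} {b} a-b≡0 = begin
    a             ≡⟨ solve 2 (λ a b → a := (a :- b) :+ b) refl a b ⟩
    (a - b) + b   ≡⟨ cong (_+ b) a-b≡0 ⟩
    0ℚ + b        ≡⟨ +-identityˡ b ⟩
    b             ∎
    where open ≡-Reasoning

  b-a≡-[a-b] : ∀ a b → b - a ≡ - (a - b)
  b-a≡-[a-b] = solve 2 (λ a b → b :- a := :- (a :- b)) refl

  0<-a⇒a<0 : ∀ {a} → 0ℚ < - a → a < 0ℚ
  0<-a⇒a<0 {a} 0<-a = subst (_< 0ℚ) (solve 1 (λ a → :- (:- a) := a) refl a) (neg-antimono-< 0<-a)

  a<0⇒0<-a : ∀ {a} → a < 0ℚ → 0ℚ < - a
  a<0⇒0<-a = neg-antimono-<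

  ≢0∧≯0⇒<0 : ∀ {a} → a ≢ 0ℚ → ¬ (0ℚ < a) → a < 0ℚ
  ≢0∧≯0⇒<0 {a} a≢0 0≮a with <-cmp a 0ℚ
  ... | tri< a<0 _ _ = a<0
  ... | tri≈ _ a≡0 _ = ⊥-elim (a≢0 a≡0)
  ... | tri> _ _ 0<a = ⊥-elim (0≮a 0<a)

  0<-sameSign : ∀ {a b} → isPositive a ≡ isPositive b → 0ℚ < a → 0ℚ < b
  0<-sameSign {a} {b} same 0<a = go (0ℚ <? b) (trans (sym same) (dec-true (0ℚ <? a) 0<a))
    where
    go : (0<b? : Dec (0ℚ < b)) → does 0<b? ≡ true → 0ℚ < b
    go (yes 0<b) _ = 0<b

  0<*-sameSign : ∀ {a b} → a ≢ 0ℚ → b ≢ 0ℚ → isPositive a ≡ isPositive b → 0ℚ < a * b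
  0<*-sameSign {a} {b} a≢0 b≢0 = go (0ℚ <? a) (0ℚ <? b)
    where
    go : (0<a? : Dec (0ℚ < a)) (0<b? : Dec (0ℚ < b)) → does 0<a? ≡ does 0<b? → 0ℚ < a * b
    go (yes 0<a) (yes 0<b) _ = positive⁻¹ (a * b) {{pos*pos⇒pos a {{positive 0<a}} b {{positive 0<b}}}}
    go (no 0≮a)  (no 0≮b)  _ = positive⁻¹ (a * b)
      {{neg*neg⇒pos a {{negative (≢0∧≯0⇒<0 a≢0 0≮a)}} b {{negative (≢0∧≯0⇒<0 b≢0 0≮b)}}}}
    go (yes _)   (no _)    ()
    go (no _)    (yes _)   ()

  0≤*-sameSign : ∀ {a b} → b ≢ 0ℚ → isPositive a ≡ isPositive b → 0ℚ ≤ a * b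
  0≤*-sameSign {a} {b} b≢0 same with a ≟ 0ℚ
  ... | yes refl = ≤-reflexive (sym (*-zeroˡ b))
  ... | no a≢0   = <⇒≤ (0<*-sameSign a≢0 b≢0 same)

module LinearDependence where

  open import Data.Nat using (ℕ; zero; suc; _<_; s≤s)
  open import Data.Nat.Properties using (<-≤-trans; ≤-reflexive)
  open import Data.Rational using (ℚ; 0ℚ; 1ℚ; _+_; _*_; -_; _-_)
  open import Data.Rational.Properties using (_≟_; 1≢0)
  open import Data.Rational.Solver using (module +-*-Solver)
  open import Data.Fin using (Fin; zero; suc)
  import Data.Fin.Properties as Fin
  open import Data.Vec using (Vec; []; _∷_; lookup; map; replicate)
  open import Data.Vec.Properties using (lookup-map)
  open import Data.List using (List; length; filter; allFin)
  open import Data.List.Properties using (filter-notAll; length-tabulate)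
  open import Data.List.Relation.Unary.All using (all?)
  open import Data.List.Relation.Unary.All.Properties using (¬All⇒Any¬)
  import Data.List.Relation.Unary.All as All
  open import Data.List.Relation.Unary.Any using (any?)
  import Data.List.Relation.Unary.Any as Any
  open import Data.List.Membership.Propositional using (_∉_; find)
  open import Data.List.Membership.Propositional.Properties using (∈-filter⁺; ∈-allFin)
  open import Data.Product using (∃-syntax; _×_; _,_; proj₁; proj₂)
  open import Data.Empty using (⊥-elim)
  open import Function using (id)
  open import Relation.Nullary using (yes; no)
  open import Relation.Nullary.Decidable using (¬?)
  open import Relation.Binary.PropositionalEquality
    using (_≡_; _≢_; refl; sym; trans; cong; cong₂; subst; module ≡-Reasoning)
  open ℚ-Lemmas using (*-≢0)
  open +-*-Solver

  Form : ℕ → Set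
  Form D = Fin D → ℚ

  infix 7 _·_
  _·_ : ∀ {k} → Vec ℚ k → Vec ℚ k → ℚ
  []       · []       = 0ℚ
  (c ∷ cs) · (e ∷ es) = c * e + cs · es

  combination : ∀ {D k} → Vec ℚ k → Vec (Form D) k → Form D
  combination c vs t = c · map (λ v → v t) vs

  NonTrivial : ∀ {k} → Vec ℚ k → Set
  NonTrivial c = ∃[ i ] lookup c i ≢ 0ℚ

  SupportedOn : ∀ {D} → List (Fin D) → Form D → Set
  SupportedOn S v = ∀ t → t ∉ S → v t ≡ 0ℚ

  combination-zero : ∀ {D k} (vs : Vec (Form D) k) t → combination (replicate k 0ℚ) vs t ≡ 0ℚ
  combination-zero []       t = refl
  combination-zero (v ∷ vs) t = trans (cong (0ℚ * v t +_) (combination-zero vs t))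
    (solve 1 (λ x → con 0ℚ :* x :+ con 0ℚ := con 0ℚ) refl (v t))

  combination-scale : ∀ {D k} a (c : Vec ℚ k) (vs : Vec (Form D) k) t →
    combination (map (a *_) c) vs t ≡ a * combination c vs t
  combination-scale a []       []       t = solve 1 (λ a → con 0ℚ := a :* con 0ℚ) refl a
  combination-scale a (c ∷ cs) (v ∷ vs) t = trans (cong (a * c * v t +_) (combination-scale a cs vs t))
    (solve 4 (λ a c v l → a :* c :* v :+ a :* l := a :* (c :* v :+ l)) refl a c (v t) (combination cs vs t))

  eliminate : ∀ {D} → Form D → Fin D → Form D → Form D
  eliminate v j u t = v j * u t - u j * v t

  combination-eliminate : ∀ {D k} (v : Form D) j (c : Vec ℚ k) (vs : Vec (Form D) k) t →
    combination c (map (eliminate v j) vs) t ≡ v j * combination c vs t - combination c vs j * v t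
  combination-eliminate v j []       []       t = solve 2 (λ a b → con 0ℚ := a :* con 0ℚ :- con 0ℚ :* b) refl (v j) (v t)
  combination-eliminate v j (c ∷ cs) (u ∷ us) t =
    trans (cong (c * eliminate v j u t +_) (combination-eliminate v j cs us t))
      (solve 7 (λ c vj ut uj vt L Lj → c :* (vj :* ut :- uj :* vt) :+ (vj :* L :- Lj :* vt)
                                     := vj :* (c :* ut :+ L) :- (c :* uj :+ Lj) :* vt)
             refl c (v j) (u t) (u j) (v t) (combination cs us t) (combination cs us j))

  remove : ∀ {D} → Fin D → List (Fin D) → List (Fin D)
  remove j = filter (λ t → ¬? (t Fin.≟ j))

  eliminate-supportedOn : ∀ {D} {S : List (Fin D)} {v u} j →
    SupportedOn S v → SupportedOn S u → SupportedOn (remove j S) (eliminate v j u)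
  eliminate-supportedOn {S = S} {v} {u} j v-supp u-supp t t∉S-j with t Fin.≟ j
  ... | yes refl = solve 2 (λ a b → a :* b :- b :* a := con 0ℚ) refl (v t) (u t)
  ... | no  t≢j  = begin
    v j * u t - u j * v t    ≡⟨ cong₂ (λ x y → v j * x - u j * y) (u-supp t t∉S) (v-supp t t∉S) ⟩
    v j * 0ℚ - u j * 0ℚ      ≡⟨ solve 2 (λ a b → a :* con 0ℚ :- b :* con 0ℚ := con 0ℚ) refl (v j) (u j) ⟩
    0ℚ                       ∎
    where
    open ≡-Reasoning
    t∉S : t ∉ S
    t∉S t∈S = t∉S-j (∈-filter⁺ (λ t → ¬? (t Fin.≟ j)) t∈S t≢j)

  -- Gaussian elimination: pivot the first form on a coordinate of S where it is nonzero.
  dependent-supported : ∀ {D} k (vs : Vec (Form D) k) (S : List (Fin D)) → length S < k →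
    (∀ i → SupportedOn S (lookup vs i)) → ∃[ c ] NonTrivial c × ∀ t → combination c vs t ≡ 0ℚ
  dependent-supported (suc k) (v ∷ vs) S (s≤s |S|≤k) supp with all? (λ t → v t ≟ 0ℚ) S
  ... | yes v≡0-on-S = 1ℚ ∷ replicate k 0ℚ , (zero , 1≢0) , λ t →
    trans (cong₂ (λ x y → 1ℚ * x + y) (v≡0 t) (combination-zero vs t)) refl
    where
    v≡0 : ∀ t → v t ≡ 0ℚ
    v≡0 t with any? (t Fin.≟_) S
    ... | yes t∈S = All.lookup v≡0-on-S t∈S
    ... | no  t∉S = supp zero t t∉S
  ... | no ¬v≡0-on-S with find (¬All⇒Any¬ (λ t → v t ≟ 0ℚ) S ¬v≡0-on-S)
  ...   | j , j∈S , vj≢0 = (- L j) ∷ map (v j *_) c′ , (suc i , vj*c′ᵢ≢0) , vanishes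
    where
    |S-j|<k : length (remove j S) < k
    |S-j|<k = <-≤-trans (filter-notAll _ S (Any.map (λ j≡t t≢j → t≢j (sym j≡t)) j∈S)) |S|≤k
    eliminated = dependent-supported k (map (eliminate v j) vs) (remove j S) |S-j|<k
      (λ i → subst (SupportedOn (remove j S)) (sym (lookup-map i (eliminate v j) vs))
                   (eliminate-supportedOn j (supp zero) (supp (suc i))))
    c′ = eliminated .proj₁
    i = eliminated .proj₂ .proj₁ .proj₁
    L = combination c′ vs
    vj*c′ᵢ≢0 : lookup (map (v j *_) c′) i ≢ 0ℚ
    vj*c′ᵢ≢0 = subst (_≢ 0ℚ) (sym (lookup-map i (v j *_) c′)) (*-≢0 vj≢0 (eliminated .proj₂ .proj₁ .proj₂))
    vanishes : ∀ t → (- L j) * v t + combination (map (v j *_) c′) vs t ≡ 0ℚ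
    vanishes t = begin
      (- L j) * v t + combination (map (v j *_) c′) vs t  ≡⟨ cong ((- L j) * v t +_) (combination-scale (v j) c′ vs t) ⟩
      (- L j) * v t + v j * L t                           ≡⟨ reorder (L j) (v t) (v j) (L t) ⟩
      v j * L t - L j * v t                               ≡⟨ combination-eliminate v j c′ vs t ⟨
      combination c′ (map (eliminate v j) vs) t           ≡⟨ eliminated .proj₂ .proj₂ t ⟩
      0ℚ                                                  ∎
      where
      open ≡-Reasoning
      reorder : ∀ a b c d → (- a) * b + c * d ≡ c * d - a * b
      reorder = solve 4 (λ a b c d → (:- a) :* b :+ c :* d := c :* d :- a :* b) refl

  dependent : ∀ {D} (vs : Vec (Form D) (suc D)) → ∃[ c ] NonTrivial c × ∀ t → combination c vs t ≡ 0ℚ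
  dependent {D} vs = dependent-supported (suc D) vs (allFin D) (s≤s (≤-reflexive (length-tabulate id)))
    (λ _ t t∉ → ⊥-elim (t∉ (∈-allFin t)))

module SignVectors where

  open import Defs using (sumChoose)
  open import Data.Nat using (ℕ; zero; suc)
  import Data.Nat as ℕ
  open import Data.Rational using (ℚ; 0ℚ; 1ℚ; _+_; _*_; -_; _-_; _<_; _≤_)
  open import Data.Rational.Properties
    using (+-*-commutativeRing; <-irrefl; *-zeroˡ; *-distribʳ-+; +-mono-≤; +-mono-<-≤; +-mono-≤-<; ≤-refl)
  open import Data.Rational.Solver using (module +-*-Solver)
  open import Algebra.Bundles using (CommutativeRing)
  open import Algebra.Properties.Semiring.Sum (CommutativeRing.semiring +-*-commutativeRing)
    using (sum-syntax; ∑-distrib-+; *-distribˡ-sum; sum-cong-≗; sum-replicate-zero; sum-remove)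
  open import Data.Bool using (Bool; if_then_else_)
  open import Data.Fin using (Fin; zero; suc; punchIn)
  import Data.Fin.Properties as Fin
  open import Data.Fin.Properties using (punchInᵢ≢i)
  open import Data.Empty using (⊥-elim)
  open import Data.Vec using (Vec; []; _∷_; lookup; map; tabulate)
  open import Data.Vec.Properties using (lookup-map; lookup∘tabulate)
  import Data.List as List
  open import Data.List using (List; length)
  open import Data.List.Properties using (length-map)
  open import Data.List.Membership.Propositional using (_∈_)
  open import Data.List.Membership.Propositional.Properties using (∈-map⁻)
  open import Data.List.Relation.Unary.Unique.Propositional using (Unique)
  open import Data.Product using (_,_; proj₁; proj₂)
  open import Relation.Nullary using (¬_; does; yes; no)
  open import Function using (_∘_)
  open import Relation.Binary.PropositionalEquality
    using (_≡_; _≢_; refl; sym; trans; cong; cong₂; subst₂; module ≡-Reasoning)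
  open SauerShelah
  open LinearDependence
  open ℚ-Lemmas
  open +-*-Solver

  ev : ∀ {D} → Form D → (Fin D → ℚ) → ℚ
  ev {D} f p = ∑[ t < D ] (f t * p t)

  ev-combination : ∀ {D k} (c : Vec ℚ k) (vs : Vec (Form D) k) p →
    ev (combination c vs) p ≡ c · map (λ v → ev v p) vs
  ev-combination {D} [] [] p = trans (sum-cong-≗ (λ t → *-zeroˡ (p t))) (sum-replicate-zero D)
  ev-combination {D} (c ∷ cs) (v ∷ vs) p = begin
    ∑[ t < D ] ((c * v t + combination cs vs t) * p t)
      ≡⟨ sum-cong-≗ (λ t → distrib c (v t) (combination cs vs t) (p t)) ⟩
    ∑[ t < D ] (c * (v t * p t) + combination cs vs t * p t)
      ≡⟨ ∑-distrib-+ (λ t → c * (v t * p t)) (λ t → combination cs vs t * p t) ⟩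
    ∑[ t < D ] (c * (v t * p t)) + ev (combination cs vs) p
      ≡⟨ cong₂ _+_ (sym (*-distribˡ-sum c (λ t → v t * p t))) (ev-combination cs vs p) ⟩
    c * ev v p + cs · map (λ v → ev v p) vs
      ∎
    where
    open ≡-Reasoning
    distrib : ∀ c v l p → (c * v + l) * p ≡ c * (v * p) + l * p
    distrib = solve 4 (λ c v l p → (c :* v :+ l) :* p := c :* (v :* p) :+ l :* p) refl

  ev-add : ∀ {D} (f g : Form D) p → ev (λ t → f t + g t) p ≡ ev f p + ev g p
  ev-add f g p = trans (sum-cong-≗ (λ t → *-distribʳ-+ (p t) (f t) (g t)))
                       (∑-distrib-+ (λ t → f t * p t) (λ t → g t * p t))

  ev-sub : ∀ {D} (f g : Form D) p → ev (λ t → f t - g t) p ≡ ev f p - ev g p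
  ev-sub f g p = begin
    ev (λ t → f t - g t) p                           ≡⟨ sum-cong-≗ (λ t → distrib (f t) (g t) (p t)) ⟩
    ∑[ t < _ ] (f t * p t + (- 1ℚ) * (g t * p t))    ≡⟨ ∑-distrib-+ (λ t → f t * p t) (λ t → (- 1ℚ) * (g t * p t)) ⟩
    ev f p + ∑[ t < _ ] ((- 1ℚ) * (g t * p t))       ≡⟨ cong (ev f p +_) (*-distribˡ-sum (- 1ℚ) (λ t → g t * p t)) ⟨
    ev f p + (- 1ℚ) * ev g p                         ≡⟨ minus (ev f p) (ev g p) ⟩
    ev f p - ev g p                                  ∎
    where
    open ≡-Reasoning
    distrib : ∀ f g p → (f - g) * p ≡ f * p + (- 1ℚ) * (g * p)
    distrib = solve 3 (λ f g p → (f :- g) :* p := f :* p :+ con (- 1ℚ) :* (g :* p)) refl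
    minus : ∀ a b → a + (- 1ℚ) * b ≡ a - b
    minus = solve 2 (λ a b → a :+ con (- 1ℚ) :* b := a :- b) refl

  δ : ∀ {D} → Fin D → Form D
  δ s t = if does (t Fin.≟ s) then 1ℚ else 0ℚ

  ev-δ : ∀ {D} (s : Fin D) p → ev (δ s) p ≡ p s
  ev-δ {suc D} s p = begin
    ev (δ s) p
      ≡⟨ sum-remove {i = s} (λ t → δ s t * p t) ⟩
    δ s s * p s + ∑[ t < D ] (δ s (punchIn s t) * p (punchIn s t))
      ≡⟨ cong₂ (λ a b → a * p s + b) δ-diag (trans (sum-cong-≗ off-diag) (sum-replicate-zero D)) ⟩
    1ℚ * p s + 0ℚ
      ≡⟨ solve 1 (λ a → con 1ℚ :* a :+ con 0ℚ := a) refl (p s) ⟩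
    p s
      ∎
    where
    open ≡-Reasoning
    δ-diag : δ s s ≡ 1ℚ
    δ-diag with s Fin.≟ s
    ... | yes _   = refl
    ... | no  s≢s = ⊥-elim (s≢s refl)
    off-diag : ∀ t → δ s (punchIn s t) * p (punchIn s t) ≡ 0ℚ
    off-diag t with punchIn s t Fin.≟ s
    ... | yes eq = ⊥-elim (punchInᵢ≢i s t eq)
    ... | no  _  = *-zeroˡ (p (punchIn s t))

  signVector : ∀ {N D} → (Fin N → Form D) → (Fin D → ℚ) → Vec Bool N
  signVector Φs p = tabulate (λ s → isPositive (ev (Φs s) p))

  SameSigns : ∀ {k} → Vec ℚ k → Vec ℚ k → Set
  SameSigns c e = ∀ i → isPositive (lookup c i) ≡ isPositive (lookup e i)

  0≤·-sameSigns : ∀ {k} (c e : Vec ℚ k) → (∀ i → lookup e i ≢ 0ℚ) → SameSigns c e → 0ℚ ≤ c · e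
  0≤·-sameSigns []       []       _   _    = ≤-refl
  0≤·-sameSigns (c ∷ cs) (e ∷ es) e≢0 same =
    +-mono-≤ (0≤*-sameSign {c} (e≢0 zero) (same zero)) (0≤·-sameSigns cs es (e≢0 ∘ suc) (same ∘ suc))

  0<·-sameSigns : ∀ {k} (c e : Vec ℚ k) → (∀ i → lookup e i ≢ 0ℚ) → SameSigns c e → NonTrivial c → 0ℚ < c · e
  0<·-sameSigns (c ∷ cs) (e ∷ es) e≢0 same (zero , c≢0) =
    +-mono-<-≤ (0<*-sameSign {c} c≢0 (e≢0 zero) (same zero)) (0≤·-sameSigns cs es (e≢0 ∘ suc) (same ∘ suc))
  0<·-sameSigns (c ∷ cs) (e ∷ es) e≢0 same (suc i , cᵢ≢0) =
    +-mono-≤-< (0≤*-sameSign {c} (e≢0 zero) (same zero)) (0<·-sameSigns cs es (e≢0 ∘ suc) (same ∘ suc) (i , cᵢ≢0))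

  Generic : ∀ {N D} → (Fin N → Form D) → List (Fin D → ℚ) → Set
  Generic Φs P = ∀ {p} → p ∈ P → ∀ s → ev (Φs s) p ≢ 0ℚ

  signVectors-¬shatter : ∀ {N D} (Φs : Fin N → Form D) (P : List (Fin D → ℚ)) → Generic Φs P →
    ∀ (S : Vec (Fin N) (suc D)) → ¬ Shatters (List.map (signVector Φs) P) S
  signVectors-¬shatter {D = D} Φs P generic S shatters = <-irrefl (sym c·e≡0) (0<·-sameSigns c e e≢0 same nontrivial)
    where
    vs = map Φs S
    dependency = dependent vs
    c = dependency .proj₁
    nontrivial = dependency .proj₂ .proj₁
    realised = shatters (map isPositive c)
    v∈ = realised .proj₂ .proj₁
    p = ∈-map⁻ (signVector Φs) v∈ .proj₁
    p∈P = ∈-map⁻ (signVector Φs) v∈ .proj₂ .proj₁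
    v≡ = ∈-map⁻ (signVector Φs) v∈ .proj₂ .proj₂
    e = map (λ w → ev w p) vs

    eᵢ : ∀ i → lookup e i ≡ ev (Φs (lookup S i)) p
    eᵢ i = trans (lookup-map i (λ w → ev w p) vs) (cong (λ w → ev w p) (lookup-map i Φs S))

    e≢0 : ∀ i → lookup e i ≢ 0ℚ
    e≢0 i eᵢ≡0 = generic p∈P (lookup S i) (trans (sym (eᵢ i)) eᵢ≡0)

    same : SameSigns c e
    same i = begin
      isPositive (lookup c i)                  ≡⟨ lookup-map i isPositive c ⟨
      lookup (map isPositive c) i              ≡⟨ realised .proj₂ .proj₂ i ⟨
      lookup (realised .proj₁) (lookup S i)    ≡⟨ cong (λ w → lookup w (lookup S i)) v≡ ⟩
      lookup (signVector Φs p) (lookup S i)    ≡⟨ lookup∘tabulate _ (lookup S i) ⟩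
      isPositive (ev (Φs (lookup S i)) p)      ≡⟨ cong isPositive (eᵢ i) ⟨
      isPositive (lookup e i)                  ∎
      where open ≡-Reasoning

    c·e≡0 : c · e ≡ 0ℚ
    c·e≡0 = trans (sym (ev-combination c vs p)) (trans (sum-cong-≗ zero-term) (sum-replicate-zero D))
      where
      zero-term : ∀ t → combination c vs t * p t ≡ 0ℚ
      zero-term t = trans (cong (_* p t) (dependency .proj₂ .proj₂ t)) (*-zeroˡ (p t))

  length≤sumChoose : ∀ {N D} (Φs : Fin N → Form D) (P : List (Fin D → ℚ)) → Generic Φs P →
    Unique (List.map (signVector Φs) P) → length P ℕ.≤ sumChoose N D
  length≤sumChoose {N} {D} Φs P generic distinct =
    subst₂ ℕ._≤_ (length-map (signVector Φs) P) (Φ-suc≡sumChoose N D)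
      (sauer-shelah N (suc D) _ distinct (signVectors-¬shatter Φs P generic))

module Permutations where

  open import Data.Nat using (ℕ; zero; suc; _*_; _!; z≤n)
  import Data.Nat as ℕ
  import Data.Nat.Properties as ℕ
  open import Data.Fin using (Fin; zero; suc; toℕ; fromℕ<; _<_; _≤_)
  open import Data.Fin.Properties
    using (punchIn-injective; <-cmp; <⇒≢; <-asym; toℕ-fromℕ<; fromℕ<-toℕ; toℕ<n; ≤-antisym)
  open import Data.Fin.Permutation using (Permutation′; _⟨$⟩ʳ_; _⟨$⟩ˡ_; inverseˡ; inverseʳ; insert; id; _≈_)
  open import Data.List using (List; []; _∷_; length; allFin; cartesianProductWith)
  open import Data.List.Properties using (length-tabulate)
  open import Data.List.Relation.Unary.AllPairs using ([]; _∷_)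
  open import Data.List.Relation.Unary.All using ([])
  open import Data.List.Relation.Unary.Unique.Setoid using (Unique)
  open import Data.List.Relation.Unary.Unique.Setoid.Properties using (cartesianProductWith⁺)
  open import Data.List.Relation.Unary.Unique.Propositional.Properties using (allFin⁺)
  open import Data.Product using (_×_; _,_)
  open import Data.Empty using (⊥-elim)
  open import Relation.Binary using (Setoid)
  open import Relation.Binary.Definitions using (tri<; tri≈; tri>)
  import Relation.Binary.Construct.On as On
  open import Relation.Binary.PropositionalEquality
    using (_≡_; refl; sym; trans; cong; cong₂; subst; subst₂; setoid; _→-setoid_; module ≡-Reasoning)
  open ListProperties using (length-cartesianProductWith)

  ≈-setoid : ℕ → Setoid _ _
  ≈-setoid m = On.setoid (Fin m →-setoid Fin m) (_⟨$⟩ʳ_ {m})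

  permutations : ∀ m → List (Permutation′ m)
  permutations zero    = id ∷ []
  permutations (suc m) = cartesianProductWith (λ π j → insert zero j π) (permutations m) (allFin (suc m))

  length-permutations : ∀ m → length (permutations m) ≡ m !
  length-permutations zero    = refl
  length-permutations (suc m) = trans (length-cartesianProductWith _ (permutations m) (allFin (suc m)))
    (trans (cong₂ _*_ (length-permutations m) (length-tabulate {n = suc m} (λ j → j))) (ℕ.*-comm (m !) (suc m)))

  insert-zero-injective : ∀ {m} {π ρ : Permutation′ m} {j k} → insert zero j π ≈ insert zero k ρ → π ≈ ρ × j ≡ k
  insert-zero-injective {j = j} eq with eq zero
  ... | refl = (λ a → punchIn-injective j _ _ (eq (suc a))) , refl

  permutations-unique : ∀ m → Unique (≈-setoid m) (permutations m)
  permutations-unique zero    = [] ∷ []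
  permutations-unique (suc m) = cartesianProductWith⁺ (≈-setoid m) (setoid (Fin (suc m))) (≈-setoid (suc m))
    _ insert-zero-injective (permutations-unique m) (allFin⁺ (suc m))

  strictlyMonotone⇒inflationary : ∀ {m} (f : Fin m → Fin m) → (∀ {u v} → u < v → f u < f v) → ∀ i → i ≤ f i
  strictlyMonotone⇒inflationary {m} f mono i =
    subst (λ j → toℕ i ℕ.≤ toℕ (f j)) (fromℕ<-toℕ i (toℕ<n i)) (go (toℕ i) (toℕ<n i))
    where
    go : ∀ k (k<m : k ℕ.< m) → k ℕ.≤ toℕ (f (fromℕ< k<m))
    go zero    _     = z≤n
    go (suc k) 1+k<m = ℕ.≤-<-trans (go k k<m) (mono (subst₂ ℕ._<_ (sym (toℕ-fromℕ< k<m)) (sym (toℕ-fromℕ< 1+k<m)) k<1+k))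
      where
      k<1+k = ℕ.n<1+n k
      k<m = ℕ.<-trans k<1+k 1+k<m

  ⟨$⟩ʳ-injective : ∀ {m} (π : Permutation′ m) {a b} → π ⟨$⟩ʳ a ≡ π ⟨$⟩ʳ b → a ≡ b
  ⟨$⟩ʳ-injective π {a} {b} eq = trans (sym (inverseˡ π)) (trans (cong (π ⟨$⟩ˡ_) eq) (inverseˡ π))

  SameInversions : ∀ {m} → Permutation′ m → Permutation′ m → Set
  SameInversions σ ρ = ∀ {a b} → a < b → σ ⟨$⟩ʳ b < σ ⟨$⟩ʳ a → ρ ⟨$⟩ʳ b < ρ ⟨$⟩ʳ a

  module _ {m} {σ ρ : Permutation′ m} (σ⇒ρ : SameInversions σ ρ) (ρ⇒σ : SameInversions ρ σ) where

    ρ∘σ⁻¹-strictlyMonotone : ∀ {u v} → u < v → ρ ⟨$⟩ʳ (σ ⟨$⟩ˡ u) < ρ ⟨$⟩ʳ (σ ⟨$⟩ˡ v)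
    ρ∘σ⁻¹-strictlyMonotone {u} {v} u<v with <-cmp (σ ⟨$⟩ˡ u) (σ ⟨$⟩ˡ v)
    ... | tri≈ _ eq _ = ⊥-elim (<⇒≢ u<v (trans (sym (inverseʳ σ)) (trans (cong (σ ⟨$⟩ʳ_) eq) (inverseʳ σ))))
    ... | tri> _ _ gt = σ⇒ρ gt (subst₂ _<_ (sym (inverseʳ σ)) (sym (inverseʳ σ)) u<v)
    ... | tri< lt _ _ with <-cmp (ρ ⟨$⟩ʳ (σ ⟨$⟩ˡ u)) (ρ ⟨$⟩ʳ (σ ⟨$⟩ˡ v))
    ...   | tri< ρ-lt _ _ = ρ-lt
    ...   | tri≈ _ eq _   = ⊥-elim (<⇒≢ lt (⟨$⟩ʳ-injective ρ eq))
    ...   | tri> _ _ ρ-gt = ⊥-elim (<-asym u<v (subst₂ _<_ (inverseʳ σ) (inverseʳ σ) (ρ⇒σ lt ρ-gt)))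

  sameInversions⇒≈ : ∀ {m} {σ ρ : Permutation′ m} → SameInversions σ ρ → SameInversions ρ σ → σ ≈ ρ
  sameInversions⇒≈ {m} {σ} {ρ} σ⇒ρ ρ⇒σ a = begin
    σ ⟨$⟩ʳ a                    ≡⟨ ≤-antisym u≤fu fu≤u ⟩
    ρ ⟨$⟩ʳ (σ ⟨$⟩ˡ (σ ⟨$⟩ʳ a))    ≡⟨ cong (ρ ⟨$⟩ʳ_) (inverseˡ σ) ⟩
    ρ ⟨$⟩ʳ a                    ∎
    where
    open ≡-Reasoning
    f g : Fin m → Fin m
    f u = ρ ⟨$⟩ʳ (σ ⟨$⟩ˡ u)
    g u = σ ⟨$⟩ʳ (ρ ⟨$⟩ˡ u)
    u : Fin m
    u = σ ⟨$⟩ʳ a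
    u≤fu : u ≤ f u
    u≤fu = strictlyMonotone⇒inflationary f (ρ∘σ⁻¹-strictlyMonotone {σ = σ} {ρ} σ⇒ρ ρ⇒σ) u
    fu≤u : f u ≤ u
    fu≤u = subst (f u ≤_) (trans (cong (σ ⟨$⟩ʳ_) (inverseˡ ρ)) (inverseʳ σ))
             (strictlyMonotone⇒inflationary g (ρ∘σ⁻¹-strictlyMonotone {σ = ρ} {σ} ρ⇒σ σ⇒ρ) (f u))

module Realizations where

  open import Defs
  open import Data.Nat using (suc)
  open import Data.Nat.ListAction using (sum)
  open import Data.Rational using (ℚ; 0ℚ; _+_; _-_; _<_)
  open import Data.Rational.Properties using (_<?_; <-irrefl; <-asym)
  open import Data.Fin using (Fin)
  import Data.Fin as Fin
  open import Data.Fin.Properties using (<-cmp)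
  open import Data.Fin.Permutation using (Permutation′; _⟨$⟩ʳ_)
  open import Data.Vec using (Vec; lookup)
  open import Data.Vec.Properties using (tabulate∘lookup; tabulate-cong)
  open import Data.List using (allFin)
  open import Data.List.Properties using (map-cong)
  open import Data.Bool using (if_then_else_)
  open import Data.Empty using (⊥-elim)
  open import Function using (_⇔_)
  open import Relation.Nullary.Decidable using (does-⇔)
  open import Relation.Binary.Definitions using (tri<; tri≈; tri>)
  open import Relation.Binary.PropositionalEquality using (_≡_; refl; sym; trans; cong)
  open ℚ-Lemmas using (a<b⇒0<b-a; 0<b-a⇒a<b)
  open Permutations using (SameInversions)

  module _ {k} {x : Fin k → ℚ} (x↑ : Increasing x) where

    increasing-injective : ∀ {i j} → x i ≡ x j → i ≡ j
    increasing-injective {i} {j} xi≡xj with <-cmp i j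
    ... | tri< i<j _ _ = ⊥-elim (<-irrefl xi≡xj (x↑ i j i<j))
    ... | tri≈ _ i≡j _ = i≡j
    ... | tri> _ _ j<i = ⊥-elim (<-irrefl (sym xi≡xj) (x↑ j i j<i))

    increasing-reflects-< : ∀ {i j} → x i < x j → i Fin.< j
    increasing-reflects-< {i} {j} xi<xj with <-cmp i j
    ... | tri< i<j _ _    = i<j
    ... | tri≈ _ refl _   = ⊥-elim (<-irrefl refl xi<xj)
    ... | tri> _ _ j<i    = ⊥-elim (<-asym xi<xj (x↑ j i j<i))

  inversions-transfer : ∀ {k} {z z′ : Fin k → ℚ} {π π′ : Permutation′ k} → Increasing z → Increasing z′ →
    (∀ {a b} → a Fin.< b → 0ℚ < z (π ⟨$⟩ʳ a) - z (π ⟨$⟩ʳ b) → 0ℚ < z′ (π′ ⟨$⟩ʳ a) - z′ (π′ ⟨$⟩ʳ b)) →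
    SameInversions π π′
  inversions-transfer z↑ z′↑ transfer a<b πb<πa =
    increasing-reflects-< z′↑ (0<b-a⇒a<b (transfer a<b (a<b⇒0<b-a (z↑ _ _ πb<πa))))

  rank-cong : ∀ {m n} {x x′ : Fin m → ℚ} {y y′ : Fin n → ℚ} →
    (∀ i j k l → (x k + y l < x i + y j) ⇔ (x′ k + y′ l < x′ i + y′ j)) →
    ∀ i j → rank x y i j ≡ rank x′ y′ i j
  rank-cong {m} {n} {x} {x′} {y} {y′} same-order i j =
    cong suc (cong sum (map-cong (λ k → cong sum (map-cong (λ l →
      cong (λ b → if b then 1 else 0) (does-⇔ (same-order i j k l) (_ <? _) (_ <? _))) (allFin n))) (allFin m)))

  tableau-ext : ∀ {m n} {T T′ : Tableau m n} → (∀ i j → entry T i j ≡ entry T′ i j) → T ≡ T′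
  tableau-ext {T = T} {T′} T≗T′ = vec-ext (λ i → vec-ext (T≗T′ i))
    where
    vec-ext : ∀ {A : Set} {k} {u v : Vec A k} → (∀ i → lookup u i ≡ lookup v i) → u ≡ v
    vec-ext {u = u} {v} u≗v = trans (sym (tabulate∘lookup u)) (trans (tabulate-cong u≗v) (tabulate∘lookup v))

module SumOrderArrangement (m n : ℕ) where

  open import Defs
  open import Data.Nat using (zero; suc; _*_; _!)
  import Data.Nat as ℕ
  open import Data.Nat.Tactic.RingSolver using (solve-∀)
  open import Data.Nat.Combinatorics using (_C_; nCk+nC[k+1]≡[n+1]C[k+1]; nC1≡n)
  open import Data.Rational using (ℚ; 0ℚ; _+_; -_; _-_; _<_)
  open import Data.Rational.Properties using (<-irrefl; <-asym)
  open import Data.Rational.Solver using (module +-*-Solver)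
  open import Data.Fin using (Fin; zero; suc; _↑ˡ_; _↑ʳ_; splitAt)
  import Data.Fin as Fin
  open import Data.Fin.Properties using (<-cmp; <⇒≢; splitAt-↑ˡ; splitAt-↑ʳ)
  open import Data.Fin.Permutation using (Permutation′; _⟨$⟩ʳ_; _⟨$⟩ˡ_; inverseʳ; _≈_)
  open import Data.List using (List; []; length; _++_; map; allFin; cartesianProductWith; cartesianProduct)
  import Data.List as List
  import Data.Vec as Vec
  open import Data.Vec.Properties using (lookup∘tabulate)
  open import Data.List.Relation.Unary.Any using (index)
  open import Data.List.Relation.Unary.Any.Properties using (lookup-index)
  open import Data.List.Relation.Unary.All using (All)
  import Data.List.Relation.Unary.All as All
  open import Data.List.Relation.Unary.Unique.Propositional using (Unique)
  open import Data.List.Properties using (length-++; length-map; length-tabulate; map-∘)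
  open import Data.List.Relation.Unary.Unique.Setoid using () renaming (Unique to Unique≈)
  import Data.List.Relation.Unary.Unique.Setoid.Properties as Unique
  open import Data.List.Membership.Propositional using (_∈_)
  open import Data.List.Membership.Propositional.Properties
    using (∈-++⁺ˡ; ∈-++⁺ʳ; ∈-++⁻; ∈-map⁺; ∈-map⁻; ∈-allFin; ∈-lookup; ∈-cartesianProductWith⁺; ∈-cartesianProductWith⁻)
  open import Data.Product using (Σ; ∃-syntax; _×_; _,_; proj₁; proj₂; uncurry)
  open import Data.Sum using (_⊎_; inj₁; inj₂; [_,_]′)
  open import Data.Empty using (⊥-elim)
  open import Function using (_∘_; _⇔_; mk⇔)
  open import Relation.Binary using (Setoid)
  import Relation.Binary.Construct.On as On
  open import Data.Product.Relation.Binary.Pointwise.NonDependent using (_×ₛ_)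
  open import Relation.Nullary using (¬_)
  open import Relation.Binary.Definitions using (tri<; tri≈; tri>)
  open import Relation.Binary.PropositionalEquality
    using (_≡_; _≢_; refl; sym; trans; cong; cong₂; subst; subst₂; setoid; module ≡-Reasoning)
  open LinearDependence using (Form)
  open SignVectors
  open Permutations
    using (permutations; length-permutations; permutations-unique; ⟨$⟩ʳ-injective; ≈-setoid; sameInversions⇒≈)
  open ListProperties using (length-cartesianProductWith; map-proj₁-toList)
  open Realizations
  open ℚ-Lemmas
  open +-*-Solver

  D : ℕ
  D = m ℕ.+ n

  xᵢ : Fin m → Fin D
  xᵢ a = a ↑ˡ n

  yⱼ : Fin n → Fin D
  yⱼ j = m ↑ʳ j

  Point : Set
  Point = Fin D → ℚ

  data Hyperplane : Set where
    x-diff   : Fin m → Fin m → Hyperplane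
    y-diff   : Fin n → Fin n → Hyperplane
    sum-diff : Fin m → Fin m → Fin n → Fin n → Hyperplane

  cell : Point → Fin m → Fin n → ℚ
  cell p a j = p (xᵢ a) + p (yⱼ j)

  value : Hyperplane → Point → ℚ
  value (x-diff a b)       p = p (xᵢ a) - p (xᵢ b)
  value (y-diff j l)       p = p (yⱼ j) - p (yⱼ l)
  value (sum-diff a b j l) p = cell p a j - cell p b l

  form : Hyperplane → Form D
  form (x-diff a b)       t = δ (xᵢ a) t - δ (xᵢ b) t
  form (y-diff j l)       t = δ (yⱼ j) t - δ (yⱼ l) t
  form (sum-diff a b j l) t = (δ (xᵢ a) t + δ (yⱼ j) t) - (δ (xᵢ b) t + δ (yⱼ l) t)

  ev-form : ∀ h p → ev (form h) p ≡ value h p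
  ev-form (x-diff a b) p = trans (ev-sub (δ (xᵢ a)) (δ (xᵢ b)) p) (cong₂ _-_ (ev-δ (xᵢ a) p) (ev-δ (xᵢ b) p))
  ev-form (y-diff j l) p = trans (ev-sub (δ (yⱼ j)) (δ (yⱼ l)) p) (cong₂ _-_ (ev-δ (yⱼ j) p) (ev-δ (yⱼ l) p))
  ev-form (sum-diff a b j l) p = trans (ev-sub (λ t → δ (xᵢ a) t + δ (yⱼ j) t) (λ t → δ (xᵢ b) t + δ (yⱼ l) t) p)
    (cong₂ _-_ (ev-cell a j) (ev-cell b l))
    where
    ev-cell : ∀ a j → ev (λ t → δ (xᵢ a) t + δ (yⱼ j) t) p ≡ cell p a j
    ev-cell a j = trans (ev-add (δ (xᵢ a)) (δ (yⱼ j)) p) (cong₂ _+_ (ev-δ (xᵢ a) p) (ev-δ (yⱼ j) p))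

  pairs : ∀ k → List (Fin k × Fin k)
  pairs zero    = []
  pairs (suc k) = map (λ b → zero , suc b) (allFin k) ++ map (λ (a , b) → suc a , suc b) (pairs k)

  ∈-pairs⁻ : ∀ k {a b} → (a , b) ∈ pairs k → a Fin.< b
  ∈-pairs⁻ (suc k) ab∈ with ∈-++⁻ (map (λ b → zero , suc b) (allFin k)) ab∈
  ... | inj₁ ab∈₀ with ∈-map⁻ _ ab∈₀
  ...   | _ , _ , refl = ℕ.s≤s ℕ.z≤n
  ∈-pairs⁻ (suc k) ab∈ | inj₂ ab∈₊ with ∈-map⁻ _ ab∈₊
  ...   | _ , cd∈ , refl = ℕ.s≤s (∈-pairs⁻ k cd∈)

  ∈-pairs⁺ : ∀ k {a b : Fin k} → a Fin.< b → (a , b) ∈ pairs k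
  ∈-pairs⁺ (suc k) {zero}  {suc b} _             = ∈-++⁺ˡ (∈-map⁺ _ (∈-allFin b))
  ∈-pairs⁺ (suc k) {suc a} {suc b} (ℕ.s≤s a<b) = ∈-++⁺ʳ _ (∈-map⁺ _ (∈-pairs⁺ k a<b))

  length-pairs : ∀ k → length (pairs k) ≡ k C 2
  length-pairs zero    = refl
  length-pairs (suc k) = begin
    length (map (λ b → zero , suc b) (allFin k) ++ map _ (pairs k))
      ≡⟨ length-++ (map (λ b → zero , suc b) (allFin k)) ⟩
    length (map _ (allFin k)) ℕ.+ length (map _ (pairs k))
      ≡⟨ cong₂ ℕ._+_ (trans (length-map _ (allFin k)) (length-tabulate {n = k} (λ b → b)))
                     (trans (length-map _ (pairs k)) (length-pairs k)) ⟩
    k ℕ.+ k C 2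
      ≡⟨ cong (ℕ._+ k C 2) (nC1≡n k) ⟨
    k C 1 ℕ.+ k C 2
      ≡⟨ nCk+nC[k+1]≡[n+1]C[k+1] k 1 ⟩
    suc k C 2
      ∎
    where open ≡-Reasoning

  x-diffs : List Hyperplane
  x-diffs = map (uncurry x-diff) (pairs m)

  y-diffs : List Hyperplane
  y-diffs = map (uncurry y-diff) (pairs n)

  sum-diffs⁺ : List Hyperplane
  sum-diffs⁺ = cartesianProductWith (λ (a , b) (j , l) → sum-diff a b j l) (pairs m) (pairs n)

  sum-diffs⁻ : List Hyperplane
  sum-diffs⁻ = cartesianProductWith (λ (a , b) (j , l) → sum-diff a b l j) (pairs m) (pairs n)

  hyperplanes : List Hyperplane
  hyperplanes = x-diffs ++ y-diffs ++ sum-diffs⁺ ++ sum-diffs⁻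

  length-hyperplanes : length hyperplanes ≡ boundN m n
  length-hyperplanes = begin
    length hyperplanes
      ≡⟨ trans (length-++ x-diffs) (cong (length x-diffs ℕ.+_) (trans (length-++ y-diffs)
           (cong (length y-diffs ℕ.+_) (length-++ sum-diffs⁺)))) ⟩
    length x-diffs ℕ.+ (length y-diffs ℕ.+ (length sum-diffs⁺ ℕ.+ length sum-diffs⁻))
      ≡⟨ cong₂ ℕ._+_ (length-map _ (pairs m)) (cong₂ ℕ._+_ (length-map _ (pairs n))
           (cong₂ ℕ._+_ (length-cartesianProductWith _ (pairs m) (pairs n))
                        (length-cartesianProductWith _ (pairs m) (pairs n)))) ⟩
    Pm ℕ.+ (Pn ℕ.+ (Pm * Pn ℕ.+ Pm * Pn))
      ≡⟨ count Pm Pn ⟩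
    2 * Pm * Pn ℕ.+ Pm ℕ.+ Pn
      ≡⟨ cong₂ (λ a b → 2 * a * b ℕ.+ a ℕ.+ b) (length-pairs m) (length-pairs n) ⟩
    boundN m n ∎
    where
    open ≡-Reasoning
    Pm = length (pairs m)
    Pn = length (pairs n)
    count : ∀ a b → a ℕ.+ (b ℕ.+ (a * b ℕ.+ a * b)) ≡ 2 * a * b ℕ.+ a ℕ.+ b
    count = solve-∀

  x-diff∈ : ∀ {a b} → a Fin.< b → x-diff a b ∈ hyperplanes
  x-diff∈ a<b = ∈-++⁺ˡ (∈-map⁺ (uncurry x-diff) (∈-pairs⁺ m a<b))

  y-diff∈ : ∀ {j l} → j Fin.< l → y-diff j l ∈ hyperplanes
  y-diff∈ j<l = ∈-++⁺ʳ x-diffs (∈-++⁺ˡ (∈-map⁺ (uncurry y-diff) (∈-pairs⁺ n j<l)))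

  sum-diff∈ : ∀ {a b j l} → a Fin.< b → j Fin.< l ⊎ l Fin.< j → sum-diff a b j l ∈ hyperplanes
  sum-diff∈ a<b (inj₁ j<l) = ∈-++⁺ʳ x-diffs (∈-++⁺ʳ y-diffs (∈-++⁺ˡ
    (∈-cartesianProductWith⁺ (λ (a , b) (j , l) → sum-diff a b j l) (∈-pairs⁺ m a<b) (∈-pairs⁺ n j<l))))
  sum-diff∈ a<b (inj₂ l<j) = ∈-++⁺ʳ x-diffs (∈-++⁺ʳ y-diffs (∈-++⁺ʳ sum-diffs⁺
    (∈-cartesianProductWith⁺ (λ (a , b) (j , l) → sum-diff a b l j) (∈-pairs⁺ m a<b) (∈-pairs⁺ n l<j))))

  Admissible : Hyperplane → Set
  Admissible (x-diff a b)       = a Fin.< b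
  Admissible (y-diff j l)       = j Fin.< l
  Admissible (sum-diff a b _ _) = a Fin.< b

  ∈-hyperplanes⁻ : ∀ {h} → h ∈ hyperplanes → Admissible h
  ∈-hyperplanes⁻ h∈ with ∈-++⁻ x-diffs h∈
  ... | inj₁ h∈x with ∈-map⁻ _ h∈x
  ...   | _ , ab∈ , refl = ∈-pairs⁻ m ab∈
  ∈-hyperplanes⁻ h∈ | inj₂ h∈′ with ∈-++⁻ y-diffs h∈′
  ... | inj₁ h∈y with ∈-map⁻ _ h∈y
  ...   | _ , jl∈ , refl = ∈-pairs⁻ n jl∈
  ∈-hyperplanes⁻ h∈ | inj₂ h∈′ | inj₂ h∈″ with ∈-++⁻ sum-diffs⁺ h∈″
  ... | inj₁ h∈s with ∈-cartesianProductWith⁻ _ (pairs m) (pairs n) h∈s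
  ...   | _ , _ , ab∈ , _ , refl = ∈-pairs⁻ m ab∈
  ∈-hyperplanes⁻ h∈ | inj₂ h∈′ | inj₂ h∈″ | inj₂ h∈s with ∈-cartesianProductWith⁻ _ (pairs m) (pairs n) h∈s
  ...   | _ , _ , ab∈ , _ , refl = ∈-pairs⁻ m ab∈

  Expressible : (Point → ℚ) → Set
  Expressible f = (∀ p → f p ≡ 0ℚ)
                ⊎ ∃[ h ] h ∈ hyperplanes × ((∀ p → f p ≡ value h p) ⊎ (∀ p → f p ≡ - value h p))

  cell-diff-expressible : ∀ a b c d → Expressible (λ p → cell p b d - cell p a c)
  cell-diff-expressible a b c d with <-cmp a b | <-cmp c d
  ... | tri≈ _ refl _ | tri≈ _ refl _ = inj₁ λ p →
          solve 1 (λ u → u :- u := con 0ℚ) refl (cell p a c)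
  ... | tri≈ _ refl _ | tri< c<d _ _  = inj₂ (y-diff c d , y-diff∈ c<d , inj₂ λ p →
          solve 3 (λ u v w → (u :+ w) :- (u :+ v) := :- (v :- w)) refl (p (xᵢ a)) (p (yⱼ c)) (p (yⱼ d)))
  ... | tri≈ _ refl _ | tri> _ _ d<c  = inj₂ (y-diff d c , y-diff∈ d<c , inj₁ λ p →
          solve 3 (λ u v w → (u :+ w) :- (u :+ v) := w :- v) refl (p (xᵢ a)) (p (yⱼ c)) (p (yⱼ d)))
  ... | tri< a<b _ _  | tri≈ _ refl _ = inj₂ (x-diff a b , x-diff∈ a<b , inj₂ λ p →
          solve 3 (λ u v w → (v :+ w) :- (u :+ w) := :- (u :- v)) refl (p (xᵢ a)) (p (xᵢ b)) (p (yⱼ c)))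
  ... | tri> _ _ b<a  | tri≈ _ refl _ = inj₂ (x-diff b a , x-diff∈ b<a , inj₁ λ p →
          solve 3 (λ u v w → (v :+ w) :- (u :+ w) := v :- u) refl (p (xᵢ a)) (p (xᵢ b)) (p (yⱼ c)))
  ... | tri< a<b _ _  | tri< c<d _ _  = inj₂ (sum-diff a b c d , sum-diff∈ a<b (inj₁ c<d) , inj₂ λ p →
          b-a≡-[a-b] (cell p a c) (cell p b d))
  ... | tri< a<b _ _  | tri> _ _ d<c  = inj₂ (sum-diff a b c d , sum-diff∈ a<b (inj₂ d<c) , inj₂ λ p →
          b-a≡-[a-b] (cell p a c) (cell p b d))
  ... | tri> _ _ b<a  | tri< c<d _ _  = inj₂ (sum-diff b a d c , sum-diff∈ b<a (inj₂ c<d) , inj₁ λ p → refl)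
  ... | tri> _ _ b<a  | tri> _ _ d<c  = inj₂ (sum-diff b a d c , sum-diff∈ b<a (inj₁ d<c) , inj₁ λ p → refl)

  SameSide : Point → Point → Set
  SameSide p p′ = ∀ {h} → h ∈ hyperplanes → isPositive (value h p) ≡ isPositive (value h p′)

  OffHyperplanes : Point → Set
  OffHyperplanes p = ∀ {h} → h ∈ hyperplanes → value h p ≢ 0ℚ

  0<-transfer : ∀ {p p′} → SameSide p p′ → OffHyperplanes p′ → ∀ f → Expressible f → 0ℚ < f p → 0ℚ < f p′
  0<-transfer {p} same off f (inj₁ f≡0) 0<fp = ⊥-elim (<-irrefl (sym (f≡0 p)) 0<fp)
  0<-transfer {p} {p′} same off f (inj₂ (h , h∈ , inj₁ f≡h)) 0<fp =
    subst (0ℚ <_) (sym (f≡h p′)) (0<-sameSign (same h∈) (subst (0ℚ <_) (f≡h p) 0<fp))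
  0<-transfer {p} {p′} same off f (inj₂ (h , h∈ , inj₂ f≡-h)) 0<fp =
    subst (0ℚ <_) (sym (f≡-h p′)) (a<0⇒0<-a (≢0∧≯0⇒<0 (off h∈) 0≮hp′))
    where
    0≮hp′ : ¬ (0ℚ < value h p′)
    0≮hp′ 0<hp′ = <-asym (0<-a⇒a<0 (subst (0ℚ <_) (f≡-h p) 0<fp)) (0<-sameSign (sym (same h∈)) 0<hp′)

  point : (Fin m → ℚ) → (Fin n → ℚ) → Permutation′ m → Permutation′ n → Point
  point x y σ τ t = [ x ∘ (σ ⟨$⟩ʳ_) , y ∘ (τ ⟨$⟩ʳ_) ]′ (splitAt m t)

  module _ (x : Fin m → ℚ) (y : Fin n → ℚ) (σ : Permutation′ m) (τ : Permutation′ n) where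

    point-xᵢ : ∀ a → point x y σ τ (xᵢ a) ≡ x (σ ⟨$⟩ʳ a)
    point-xᵢ a rewrite splitAt-↑ˡ m a n = refl

    point-yⱼ : ∀ j → point x y σ τ (yⱼ j) ≡ y (τ ⟨$⟩ʳ j)
    point-yⱼ j rewrite splitAt-↑ʳ m n j = refl

    cell-point : ∀ a j → cell (point x y σ τ) a j ≡ x (σ ⟨$⟩ʳ a) + y (τ ⟨$⟩ʳ j)
    cell-point a j = cong₂ _+_ (point-xᵢ a) (point-yⱼ j)

    point-offHyperplanes : Increasing x → Increasing y → DistinctSums x y → OffHyperplanes (point x y σ τ)
    point-offHyperplanes x↑ y↑ x+y-distinct h∈ = off _ (∈-hyperplanes⁻ h∈)
      where
      off : ∀ h → Admissible h → value h (point x y σ τ) ≢ 0ℚ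
      off (x-diff a b) a<b eq = <⇒≢ a<b (⟨$⟩ʳ-injective σ (increasing-injective x↑
        (trans (sym (point-xᵢ a)) (trans (a-b≡0⇒a≡b eq) (point-xᵢ b)))))
      off (y-diff j l) j<l eq = <⇒≢ j<l (⟨$⟩ʳ-injective τ (increasing-injective y↑
        (trans (sym (point-yⱼ j)) (trans (a-b≡0⇒a≡b eq) (point-yⱼ l)))))
      off (sum-diff a b j l) a<b eq = <⇒≢ a<b (⟨$⟩ʳ-injective σ (proj₁ (x+y-distinct _ _ _ _
        (trans (sym (cell-point a j)) (trans (a-b≡0⇒a≡b eq) (cell-point b l))))))

  module Transfer (x : Fin m → ℚ) (y : Fin n → ℚ) (σ : Permutation′ m) (τ : Permutation′ n)
                  (x′ : Fin m → ℚ) (y′ : Fin n → ℚ) (σ′ : Permutation′ m) (τ′ : Permutation′ n)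
                  (same : SameSide (point x y σ τ) (point x′ y′ σ′ τ′)) where

    x-order-transfer : ∀ {a b} → a Fin.< b →
      0ℚ < x (σ ⟨$⟩ʳ a) - x (σ ⟨$⟩ʳ b) → 0ℚ < x′ (σ′ ⟨$⟩ʳ a) - x′ (σ′ ⟨$⟩ʳ b)
    x-order-transfer {a} {b} a<b 0<d = subst (0ℚ <_) (cong₂ _-_ (point-xᵢ x′ y′ σ′ τ′ a) (point-xᵢ x′ y′ σ′ τ′ b))
      (0<-sameSign (same (x-diff∈ a<b))
        (subst (0ℚ <_) (sym (cong₂ _-_ (point-xᵢ x y σ τ a) (point-xᵢ x y σ τ b))) 0<d))

    y-order-transfer : ∀ {j l} → j Fin.< l →
      0ℚ < y (τ ⟨$⟩ʳ j) - y (τ ⟨$⟩ʳ l) → 0ℚ < y′ (τ′ ⟨$⟩ʳ j) - y′ (τ′ ⟨$⟩ʳ l)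
    y-order-transfer {j} {l} j<l 0<d = subst (0ℚ <_) (cong₂ _-_ (point-yⱼ x′ y′ σ′ τ′ j) (point-yⱼ x′ y′ σ′ τ′ l))
      (0<-sameSign (same (y-diff∈ j<l))
        (subst (0ℚ <_) (sym (cong₂ _-_ (point-yⱼ x y σ τ j) (point-yⱼ x y σ τ l))) 0<d))

    sum-order-transfer : OffHyperplanes (point x′ y′ σ′ τ′) → σ ≈ σ′ → τ ≈ τ′ →
      ∀ i j k l → x k + y l < x i + y j → x′ k + y′ l < x′ i + y′ j
    sum-order-transfer off′ σ≈σ′ τ≈τ′ i j k l lt =
      0<b-a⇒a<b (subst₂ (λ u v → 0ℚ < u - v) (cell≡ x′ y′ σ′ τ′ σ≈σ′ τ≈τ′ i j) (cell≡ x′ y′ σ′ τ′ σ≈σ′ τ≈τ′ k l)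
        (0<-transfer same off′ _ (cell-diff-expressible (σ ⟨$⟩ˡ k) (σ ⟨$⟩ˡ i) (τ ⟨$⟩ˡ l) (τ ⟨$⟩ˡ j))
          (subst₂ (λ u v → 0ℚ < u - v) (sym (cell≡ x y σ τ σ≈σ τ≈τ i j)) (sym (cell≡ x y σ τ σ≈σ τ≈τ k l))
            (a<b⇒0<b-a lt))))
      where
      σ≈σ : σ ≈ σ
      σ≈σ _ = refl
      τ≈τ : τ ≈ τ
      τ≈τ _ = refl
      cell≡ : ∀ x₀ y₀ σ₀ τ₀ → σ ≈ σ₀ → τ ≈ τ₀ → ∀ i j → cell (point x₀ y₀ σ₀ τ₀) (σ ⟨$⟩ˡ i) (τ ⟨$⟩ˡ j) ≡ x₀ i + y₀ j
      cell≡ x₀ y₀ σ₀ τ₀ σ≈ τ≈ i j = trans (cell-point x₀ y₀ σ₀ τ₀ _ _)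
        (cong₂ _+_ (cong x₀ (trans (sym (σ≈ _)) (inverseʳ σ))) (cong y₀ (trans (sym (τ≈ _)) (inverseʳ τ))))

  Labelled : Set
  Labelled = Σ (Tableau m n) Realizable × Permutation′ m × Permutation′ n

  realizedSetoid : Setoid _ _
  realizedSetoid = On.setoid (setoid (Tableau m n)) (proj₁ {B = Realizable})

  labelledSetoid : Setoid _ _
  labelledSetoid = realizedSetoid ×ₛ (≈-setoid m ×ₛ ≈-setoid n)

  labelPoint : Labelled → Point
  labelPoint ((_ , x , y , _) , σ , τ) = point x y σ τ

  labelPoint-offHyperplanes : ∀ k → OffHyperplanes (labelPoint k)
  labelPoint-offHyperplanes ((_ , x , y , x↑ , y↑ , x+y-distinct , _) , σ , τ) =
    point-offHyperplanes x y σ τ x↑ y↑ x+y-distinct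

  sameSide-sym : ∀ {p p′} → SameSide p p′ → SameSide p′ p
  sameSide-sym same h∈ = sym (same h∈)

  sameSide⇒≈ : ∀ k k′ → SameSide (labelPoint k) (labelPoint k′) → Setoid._≈_ labelledSetoid k k′
  sameSide⇒≈ k@((T , x , y , x↑ , y↑ , _ , T≡rank) , σ , τ)
             k′@((T′ , x′ , y′ , x′↑ , y′↑ , _ , T′≡rank) , σ′ , τ′) same = T≡T′ , σ≈σ′ , τ≈τ′
    where
    module Fwd = Transfer x y σ τ x′ y′ σ′ τ′ same
    module Bwd = Transfer x′ y′ σ′ τ′ x y σ τ (sameSide-sym {labelPoint k} same)

    σ≈σ′ : σ ≈ σ′
    σ≈σ′ = sameInversions⇒≈ {σ = σ} {σ′}
      (inversions-transfer {π = σ} {σ′} x↑ x′↑ Fwd.x-order-transfer)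
      (inversions-transfer {π = σ′} {σ} x′↑ x↑ Bwd.x-order-transfer)

    τ≈τ′ : τ ≈ τ′
    τ≈τ′ = sameInversions⇒≈ {σ = τ} {τ′}
      (inversions-transfer {π = τ} {τ′} y↑ y′↑ Fwd.y-order-transfer)
      (inversions-transfer {π = τ′} {τ} y′↑ y↑ Bwd.y-order-transfer)

    same-order : ∀ i j i₀ j₀ → (x i₀ + y j₀ < x i + y j) ⇔ (x′ i₀ + y′ j₀ < x′ i + y′ j)
    same-order i j i₀ j₀ = mk⇔
      (Fwd.sum-order-transfer (labelPoint-offHyperplanes k′) σ≈σ′ τ≈τ′ i j i₀ j₀)
      (Bwd.sum-order-transfer (labelPoint-offHyperplanes k) (sym ∘ σ≈σ′) (sym ∘ τ≈τ′) i j i₀ j₀)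

    T≡T′ : T ≡ T′
    T≡T′ = tableau-ext λ i j →
      trans (T≡rank i j) (trans (rank-cong {x = x} {x′} {y} {y′} same-order i j) (sym (T′≡rank i j)))

  hyperplaneForms : Fin (length hyperplanes) → Form D
  hyperplaneForms s = form (List.lookup hyperplanes s)

  lookup-signVector : ∀ {h} (h∈ : h ∈ hyperplanes) p →
    Vec.lookup (signVector hyperplaneForms p) (index h∈) ≡ isPositive (value h p)
  lookup-signVector {h} h∈ p = trans (lookup∘tabulate _ (index h∈))
    (cong isPositive (trans (cong (λ h → ev (form h) p) (sym (lookup-index h∈))) (ev-form h p)))

  signVector⇒sameSide : ∀ {p p′} → signVector hyperplaneForms p ≡ signVector hyperplaneForms p′ → SameSide p p′
  signVector⇒sameSide {p} {p′} eq h∈ =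
    trans (sym (lookup-signVector h∈ p)) (trans (cong (λ v → Vec.lookup v (index h∈)) eq) (lookup-signVector h∈ p′))

  rSYT-bound : ∀ (L : List (Tableau m n)) → Unique L → All (IsRSYT m n) L →
    length L * (m ! * n !) ℕ.≤ sumChoose (boundN m n) D
  rSYT-bound L L! rsyt = subst₂ ℕ._≤_ length-points (cong (λ N → sumChoose N D) length-hyperplanes)
    (length≤sumChoose hyperplaneForms points off distinct)
    where
    realized = All.toList (All.map proj₂ rsyt)
    labelled = cartesianProduct realized (cartesianProduct (permutations m) (permutations n))
    points = map labelPoint labelled

    length-points : length points ≡ length L * (m ! * n !)
    length-points = begin
      length (map labelPoint labelled)
        ≡⟨ length-map labelPoint labelled ⟩
      length labelled
        ≡⟨ length-cartesianProductWith _,_ realized _ ⟩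
      length realized * length (cartesianProduct (permutations m) (permutations n))
        ≡⟨ cong₂ _*_ (trans (sym (length-map proj₁ realized)) (cong length (map-proj₁-toList (All.map proj₂ rsyt))))
                     (length-cartesianProductWith _,_ (permutations m) (permutations n)) ⟩
      length L * (length (permutations m) * length (permutations n))
        ≡⟨ cong (λ k → length L * k) (cong₂ _*_ (length-permutations m) (length-permutations n)) ⟩
      length L * (m ! * n !) ∎
      where open ≡-Reasoning

    off : ∀ {p} → p ∈ points → ∀ s → ev (hyperplaneForms s) p ≢ 0ℚ
    off p∈ s with ∈-map⁻ labelPoint p∈
    ... | k , _ , refl = λ eq →
      labelPoint-offHyperplanes k (∈-lookup s) (trans (sym (ev-form (List.lookup hyperplanes s) (labelPoint k))) eq)

    realized-unique : Unique≈ realizedSetoid realized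
    realized-unique = Unique.map⁻ realizedSetoid (setoid (Tableau m n)) (λ eq → eq)
      (subst Unique (sym (map-proj₁-toList (All.map proj₂ rsyt))) L!)

    labelled-unique : Unique≈ labelledSetoid labelled
    labelled-unique = Unique.cartesianProduct⁺ realizedSetoid (≈-setoid m ×ₛ ≈-setoid n) realized-unique
      (Unique.cartesianProduct⁺ (≈-setoid m) (≈-setoid n) (permutations-unique m) (permutations-unique n))

    distinct : Unique (map (signVector hyperplaneForms) points)
    distinct = subst Unique (map-∘ labelled) (Unique.map⁺ labelledSetoid (setoid _)
      (λ {k} {k′} eq → sameSide⇒≈ k k′ (signVector⇒sameSide {labelPoint k} {labelPoint k′} eq)) labelled-unique)

module Estimates where

  open import Defs using (sumChoose; boundN)
  open import Data.Nat using (ℕ; zero; suc; _+_; _*_; _^_; _≤_; _!; z≤n; s≤s; NonZero)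
  open import Data.Nat.Properties
  open import Data.Nat.Combinatorics using (_C_; nCk+nC[k+1]≡[n+1]C[k+1]; nC1≡n; k>n⇒nCk≡0)
  open import Data.Nat.Tactic.RingSolver using (solve-∀)
  open import Data.Nat.Solver using (module +-*-Solver)
  open +-*-Solver using (solve; _:+_; _:*_; _:^_; _:=_; con)
  open import Relation.Binary.PropositionalEquality using (_≡_; refl; sym; trans; cong; cong₂; subst)

  pascal : ∀ n k → suc n C suc k ≡ n C k + n C suc k
  pascal n k = sym (nCk+nC[k+1]≡[n+1]C[k+1] n k)

  C-monoˡ : ∀ j N i → N C i ≤ (j + N) C i
  C-monoˡ zero    N i       = ≤-refl
  C-monoˡ (suc j) N zero    = ≤-refl
  C-monoˡ (suc j) N (suc i) = ≤-trans (C-monoˡ j N (suc i))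
    (subst ((j + N) C suc i ≤_) (sym (pascal (j + N) i)) (m≤n+m _ _))

  sumChoose≤C : ∀ M k → sumChoose M k ≤ (M + k) C k
  sumChoose≤C M zero    = ≤-refl
  sumChoose≤C M (suc k) = begin
    sumChoose M k + M C suc k              ≤⟨ +-mono-≤ (sumChoose≤C M k) M≤M+k ⟩
    (M + k) C k + (M + k) C suc k          ≡⟨ pascal (M + k) k ⟨
    suc (M + k) C suc k                    ≡⟨ cong (λ N → N C suc k) (+-suc M k) ⟨
    (M + suc k) C suc k                    ∎
    where
    open ≤-Reasoning
    M≤M+k : M C suc k ≤ (M + k) C suc k
    M≤M+k = subst (λ N → M C suc k ≤ N C suc k) (+-comm k M) (C-monoˡ k M (suc k))

  absorption : ∀ n k → suc k * (suc n C suc k) ≡ suc n * (n C k)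
  absorption zero    zero    = refl
  absorption zero    (suc k) = *-zeroʳ (suc (suc k))
  absorption (suc n) zero    = trans (+-identityʳ _) (trans (nC1≡n (suc (suc n))) (sym (*-identityʳ (suc (suc n)))))
  absorption (suc n) (suc k) = begin-equality
    suc (suc k) * (suc (suc n) C suc (suc k))      ≡⟨ cong (suc (suc k) *_) (pascal (suc n) (suc k)) ⟩
    suc (suc k) * (a + b)                          ≡⟨ expand (suc k) a b ⟩
    a + suc k * a + suc (suc k) * b                ≡⟨ cong₂ (λ u v → a + u + v) (absorption n k) (absorption n (suc k)) ⟩
    a + suc n * (n C k) + suc n * (n C suc k)      ≡⟨ collect a (suc n) (n C k) (n C suc k) ⟩
    a + suc n * (n C k + n C suc k)                ≡⟨ cong (λ c → a + suc n * c) (pascal n k) ⟨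
    suc (suc n) * a                                ∎
    where
    open ≤-Reasoning
    a = suc n C suc k
    b = suc n C suc (suc k)
    expand : ∀ k a b → suc k * (a + b) ≡ a + k * a + suc k * b
    expand = solve-∀
    collect : ∀ a s c d → a + s * c + s * d ≡ a + s * (c + d)
    collect = solve-∀

  nCk*k!≤n^k : ∀ n k → (n C k) * k ! ≤ n ^ k
  nCk*k!≤n^k n       zero    = ≤-refl
  nCk*k!≤n^k zero    (suc k) = subst (λ c → c * suc k ! ≤ 0) (sym (k>n⇒nCk≡0 {0} {suc k} (s≤s z≤n))) z≤n
  nCk*k!≤n^k (suc n) (suc k) = begin
    (suc n C suc k) * (suc k * k !)  ≡⟨ rearrange (suc n C suc k) (suc k) (k !) ⟩
    suc k * (suc n C suc k) * k !    ≡⟨ cong (_* k !) (absorption n k) ⟩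
    suc n * (n C k) * k !            ≡⟨ *-assoc (suc n) (n C k) (k !) ⟩
    suc n * ((n C k) * k !)          ≤⟨ *-monoʳ-≤ (suc n) (≤-trans (nCk*k!≤n^k n k) (^-monoˡ-≤ k (n≤1+n n))) ⟩
    suc n * suc n ^ k                ∎
    where
    open ≤-Reasoning
    rearrange : ∀ c k f → c * (k * f) ≡ k * c * f
    rearrange = solve-∀

  n^k*n!≤[k+n]! : ∀ n k → n ^ k * n ! ≤ (k + n) !
  n^k*n!≤[k+n]! n zero    = ≤-reflexive (+-identityʳ (n !))
  n^k*n!≤[k+n]! n (suc k) = begin
    n * n ^ k * n !          ≡⟨ *-assoc n (n ^ k) (n !) ⟩
    n * (n ^ k * n !)        ≤⟨ *-mono-≤ (m≤n+m n (suc k)) (n^k*n!≤[k+n]! n k) ⟩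
    (suc k + n) * (k + n) !  ∎
    where open ≤-Reasoning

  [n+n]!≤4^n*n!*n! : ∀ n → (n + n) ! ≤ 4 ^ n * (n ! * n !)
  [n+n]!≤4^n*n!*n! zero    = ≤-refl
  [n+n]!≤4^n*n!*n! (suc n) = begin
    (suc n + suc n) !                         ≡⟨ cong (λ k → suc k !) (+-suc n n) ⟩
    2+2n * (suc (n + n) * (n + n) !)          ≤⟨ *-monoʳ-≤ 2+2n (*-monoˡ-≤ ((n + n) !) (n≤1+n (suc (n + n)))) ⟩
    2+2n * (2+2n * (n + n) !)                 ≤⟨ *-monoʳ-≤ 2+2n (*-monoʳ-≤ 2+2n ([n+n]!≤4^n*n!*n! n)) ⟩
    2+2n * (2+2n * (4 ^ n * (n ! * n !)))     ≡⟨ regroup n (4 ^ n) (n !) ⟩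
    4 * 4 ^ n * (suc n * n ! * (suc n * n !)) ∎
    where
    open ≤-Reasoning
    2+2n = suc (suc (n + n))
    regroup : ∀ n F f → suc (suc (n + n)) * (suc (suc (n + n)) * (F * (f * f))) ≡ 4 * F * (suc n * f * (suc n * f))
    regroup = solve-∀

  n^n≤4^n*n! : ∀ n → n ^ n ≤ 4 ^ n * n !
  n^n≤4^n*n! n = *-cancelʳ-≤ (n ^ n) (4 ^ n * n !) (n !) {{n !≢0}} (begin
    n ^ n * n !              ≤⟨ n^k*n!≤[k+n]! n n ⟩
    (n + n) !                ≤⟨ [n+n]!≤4^n*n!*n! n ⟩
    4 ^ n * (n ! * n !)      ≡⟨ *-assoc (4 ^ n) (n !) (n !) ⟨
    4 ^ n * n ! * n !        ∎)
    where open ≤-Reasoning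

  2*nC2≤n*n : ∀ n → 2 * (n C 2) ≤ n * n
  2*nC2≤n*n zero    = ≤-refl
  2*nC2≤n*n (suc n) = begin
    2 * (suc n C 2)          ≡⟨ cong (2 *_) (trans (pascal n 1) (cong (_+ n C 2) (nC1≡n n))) ⟩
    2 * (n + n C 2)          ≡⟨ *-distribˡ-+ 2 n (n C 2) ⟩
    2 * n + 2 * (n C 2)      ≤⟨ +-monoʳ-≤ (2 * n) (2*nC2≤n*n n) ⟩
    2 * n + n * n            ≤⟨ n≤1+n _ ⟩
    suc (2 * n + n * n)      ≡⟨ square (n) ⟩
    suc n * suc n            ∎
    where
    open ≤-Reasoning
    square : ∀ n → suc (2 * n + n * n) ≡ suc n * suc n
    square = solve-∀

  n≤n^[1+k] : ∀ n k → n ≤ n ^ suc k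
  n≤n^[1+k] zero    k = z≤n
  n≤n^[1+k] (suc n) k = m≤m*n (suc n) (suc n ^ k) {{m^n≢0 (suc n) k}}

  boundN+n+n≤4*n^4 : ∀ n → boundN n n + (n + n) ≤ 4 * n ^ 4
  boundN+n+n≤4*n^4 n = begin
    2 * c * c + c + c + (n + n)      ≡⟨ regroup c n ⟩
    2 * c * c + 2 * c + (n + n)      ≤⟨ +-mono-≤ (+-mono-≤ (*-mono-≤ (2*nC2≤n*n n) c≤n²) (≤-trans (2*nC2≤n*n n) n²≤n⁴))
                                                 (+-mono-≤ (n≤n^[1+k] n 3) (n≤n^[1+k] n 3)) ⟩
    n * n * (n * n) + n ^ 4 + (n ^ 4 + n ^ 4)
                                     ≡⟨ collect n ⟩
    4 * n ^ 4                        ∎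
    where
    open ≤-Reasoning
    c = n C 2
    c≤n² : c ≤ n * n
    c≤n² = ≤-trans (m≤n*m c 2) (2*nC2≤n*n n)
    n²≤n⁴ : n * n ≤ n ^ 4
    n²≤n⁴ = *-monoʳ-≤ n (n≤n^[1+k] n 2)
    regroup : ∀ c n → 2 * c * c + c + c + (n + n) ≡ 2 * c * c + 2 * c + (n + n)
    regroup = solve-∀
    collect : ∀ n → n * n * (n * n) + n ^ 4 + (n ^ 4 + n ^ 4) ≡ 4 * n ^ 4
    collect = solve 1 (λ n → n :* n :* (n :* n) :+ n :^ 4 :+ (n :^ 4 :+ n :^ 4) := con 4 :* n :^ 4) refl

  ^-distribʳ-* : ∀ a b n → (a * b) ^ n ≡ a ^ n * b ^ n
  ^-distribʳ-* a b zero    = refl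
  ^-distribʳ-* a b (suc n) = trans (cong ((a * b) *_) (^-distribʳ-* a b n)) (interchange a b (a ^ n) (b ^ n))
    where
    interchange : ∀ a b c d → a * b * (c * d) ≡ a * c * (b * d)
    interchange = solve-∀

  ^-comm-^ : ∀ a i j → (a ^ i) ^ j ≡ (a ^ j) ^ i
  ^-comm-^ a i j = trans (^-*-assoc a i j) (trans (cong (a ^_) (*-comm i j)) (sym (^-*-assoc a j i)))

  rSYT-square-bound : ∀ n .{{_ : NonZero n}} len →
    len * (n ! * n !) ≤ sumChoose (boundN n n) (n + n) → len ≤ (1024 * n ^ 4) ^ n
  rSYT-square-bound n len hyp = *-cancelʳ-≤ len ((1024 * n ^ 4) ^ n) Q {{m^n≢0 (n ^ 4) n {{m^n≢0 n 4}}}} (begin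
    len * Q                                        ≡⟨ cong (len *_) Q≡X⁴ ⟩
    len * (X * X * X * X)                          ≤⟨ *-monoʳ-≤ len (*-monoˡ-≤ X (*-mono-≤ (*-mono-≤ X≤Ff X≤Ff) X≤Ff)) ⟩
    len * ((F * f) * (F * f) * (F * f) * X)        ≡⟨ regroup len F f X ⟩
    F * F * F * (len * (f * f) * (X * f))          ≤⟨ *-monoʳ-≤ (F * F * F) (*-monoʳ-≤ (len * (f * f)) Xf≤k!) ⟩
    F * F * F * (len * (f * f) * k !)              ≤⟨ *-monoʳ-≤ (F * F * F) lhs≤ ⟩
    F * F * F * (M + k) ^ k                        ≤⟨ *-monoʳ-≤ (F * F * F) (^-monoˡ-≤ k (boundN+n+n≤4*n^4 n)) ⟩
    F * F * F * (4 * n ^ 4) ^ (n + n)              ≡⟨ powers ⟩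
    (1024 * n ^ 4) ^ n * Q                         ∎)
    where
    open ≤-Reasoning
    k = n + n
    M = boundN n n
    f = n !
    X = n ^ n
    F = 4 ^ n
    Q = (n ^ 4) ^ n

    X≤Ff : X ≤ F * f
    X≤Ff = n^n≤4^n*n! n

    Xf≤k! : X * f ≤ k !
    Xf≤k! = n^k*n!≤[k+n]! n n

    lhs≤ : len * (f * f) * k ! ≤ (M + k) ^ k
    lhs≤ = ≤-trans (*-monoˡ-≤ (k !) (≤-trans hyp (sumChoose≤C M k))) (nCk*k!≤n^k (M + k) k)

    Q≡X⁴ : Q ≡ X * X * X * X
    Q≡X⁴ = trans (^-comm-^ n 4 n) (fourth X)
      where
      fourth : ∀ x → x ^ 4 ≡ x * x * x * x
      fourth = solve 1 (λ x → x :^ 4 := x :* x :* x :* x) refl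

    regroup : ∀ l F f X → l * ((F * f) * (F * f) * (F * f) * X) ≡ F * F * F * (l * (f * f) * (X * f))
    regroup = solve-∀

    powers : F * F * F * (4 * n ^ 4) ^ (n + n) ≡ (1024 * n ^ 4) ^ n * Q
    powers = begin-equality
      F * F * F * (4 * n ^ 4) ^ (n + n)                     ≡⟨ cong (F * F * F *_) (^-distribˡ-+-* (4 * n ^ 4) n n) ⟩
      F * F * F * ((4 * n ^ 4) ^ n * (4 * n ^ 4) ^ n)       ≡⟨ cong (λ z → F * F * F * (z * z)) (^-distribʳ-* 4 _ n) ⟩
      F * F * F * ((F * Q) * (F * Q))                       ≡⟨ regroup′ F Q ⟩
      F ^ 5 * Q * Q                                         ≡⟨ cong (λ z → z * Q * Q) (^-comm-^ 4 n 5) ⟩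
      1024 ^ n * Q * Q                                      ≡⟨ cong (_* Q) (^-distribʳ-* 1024 (n ^ 4) n) ⟨
      (1024 * n ^ 4) ^ n * Q                                ∎
      where
      regroup′ : ∀ F Q → F * F * F * ((F * Q) * (F * Q)) ≡ F ^ 5 * Q * Q
      regroup′ = solve 2 (λ F Q → F :* F :* F :* ((F :* Q) :* (F :* Q)) := F :^ 5 :* Q :* Q) refl

  ^-bound-for-large-n : ∀ p q n .{{_ : NonZero n}} → 1 ≤ p → 1024 ^ q ≤ n →
    ∀ len → len ≤ (1024 * n ^ 4) ^ n → len ^ q ≤ n ^ ((4 * q + p) * n)
  ^-bound-for-large-n (suc p) q n _ 1024^q≤n len len≤ = begin
    len ^ q                                ≤⟨ ^-monoˡ-≤ q len≤ ⟩
    ((1024 * n ^ 4) ^ n) ^ q               ≡⟨ ^-comm-^ (1024 * n ^ 4) n q ⟩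
    ((1024 * n ^ 4) ^ q) ^ n               ≡⟨ cong (_^ n) (^-distribʳ-* 1024 (n ^ 4) q) ⟩
    (1024 ^ q * (n ^ 4) ^ q) ^ n           ≤⟨ ^-monoˡ-≤ n (*-monoˡ-≤ ((n ^ 4) ^ q) 1024^q≤n^p) ⟩
    (n ^ suc p * (n ^ 4) ^ q) ^ n          ≡⟨ cong (_^ n) exponents ⟩
    (n ^ (4 * q + suc p)) ^ n              ≡⟨ ^-*-assoc n (4 * q + suc p) n ⟩
    n ^ ((4 * q + suc p) * n)              ∎
    where
    open ≤-Reasoning
    1024^q≤n^p : 1024 ^ q ≤ n ^ suc p
    1024^q≤n^p = ≤-trans 1024^q≤n (n≤n^[1+k] n p)
    exponents : n ^ suc p * (n ^ 4) ^ q ≡ n ^ (4 * q + suc p)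
    exponents = begin-equality
      n ^ suc p * (n ^ 4) ^ q    ≡⟨ *-comm (n ^ suc p) _ ⟩
      (n ^ 4) ^ q * n ^ suc p    ≡⟨ cong (_* n ^ suc p) (^-*-assoc n 4 q) ⟩
      n ^ (4 * q) * n ^ suc p    ≡⟨ ^-distribˡ-+-* n (4 * q) (suc p) ⟨
      n ^ (4 * q + suc p)        ∎

open import Defs
open import Data.Nat using (_+_; _*_; _^_; _≤_; _!; >-nonZero)
open import Data.List using (List; length)
open import Data.List.Relation.Unary.All using (All)
open import Data.List.Relation.Unary.Unique.Propositional using (Unique)
open import Data.Product using (_×_; ∃-syntax; _,_)
open SumOrderArrangement using (rSYT-bound)
open Estimates using (rSYT-square-bound; ^-bound-for-large-n)

theorem1p2 :
    (∀ (m n : ℕ) → 1 ≤ m → m ≤ n →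
       CardTimesLe m n (m ! * n !) (sumChoose (boundN m n) (m + n)))
    × (∀ (p q : ℕ) → 1 ≤ p → 1 ≤ q → ∃[ N ] ∀ (n : ℕ) → 1 ≤ n → N ≤ n →
         ∀ (L : List (Tableau n n)) → Unique L → All (IsRSYT n n) L →
         length L ^ q ≤ n ^ ((4 * q + p) * n))
theorem1p2 =
    (λ m n _ _ → rSYT-bound m n)
  , λ p q 1≤p _ → 1024 ^ q , λ n 1≤n 1024^q≤n L L! rsyt →
      let instance _ = >-nonZero 1≤n in
      ^-bound-for-large-n p q n 1≤p 1024^q≤n (length L)
        (rSYT-square-bound n (length L) (rSYT-bound n n L L! rsyt))
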